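{- Let $\mathcal F$ be a positive CNF formula (a conjunction of $n$ disjunctive clauses $\mathcal C_1,\dots,\mathcal C_n$, each a disjunction of unnegated variables) over $k$ variables, where $k$ is even. Let $G_{\mathcal F}$ and $A$ be as constructed below. If Player 2 has a winning strategy for $\mathcal F$ in the POS-CNF game, then $\gamma_g(G_{\mathcal F}|A)\ge 3k+3$.
   Context: POS-CNF game on $\mathcal F$: Player 1 and Player 2 alternate turns, Player 1 first; Player 1 sets a previously unset variable TRUE, Player 2 sets a previously unset variable FALSE. When all variables are set, Player 1 wins if $\mathcal F$ evaluates to TRUE, otherwise Player 2 wins. Partially dominated graphs and the domination game: for a graph $G$ and $S\subseteq V(G)$, $G|S$ denotes $G$ in which the vertices of $S$ are declared already dominated. With $N[v]$ the closed neighborhood and $N[D]=\bigcup_{v\in D}N[v]$, the domination game on $G|S$ is played by Dominator and Staller alternately choosing vertices; a vertex may be chosen only if its closed neighborhood contains some vertex not in $S\cup N[D]$, where $D$ is the set of vertices chosen so far. The game ends when $S\cup N[D]=V(G)$. Dominator wants to minimize the number of moves, Staller to maximize it. $\gamma_g(G|S)$ is the number of moves in the game where Dominator moves first, under optimal play by both. Widget $W$: vertex set $\{a_1,a_2,x,x',y,y',z,b_1,b_2\}$; the vertices $a_2,x,x',y,y',z$ induce the complete graph on these six vertices minus the three edges $a_2z$, $xx'$, $yy'$; additionally there are edges $b_1a_1$, $a_1b_2$, $b_1x$, $b_1x'$, $b_2y$, $b_2y'$, $a_1z$ (and no others). Construction of $G_{\mathcal F}$: for each variable $X$ take a copy $W_X$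 of $W$, with vertices denoted $a_{1,X},a_{2,X},x_X,\dots$. For each clause $\mathcal C_i$ add a vertex $c_i$, adjacent to $a_{1,X}$ and $a_{2,X}$ for every variable $X$ appearing in $\mathcal C_i$. The vertices $c_1,\dots,c_n$ are pairwise adjacent (forming a clique $Q$). Finally add a path $p_1p_2p_3p_4$ and edges $p_1c_i$ and $p_4c_i$ for all $1\le i\le n$. Let $A=\{a_{1,X},a_{2,X}: X\text{ a variable of }\mathcal F\}$. -}

module Defs where

open import Data.Nat using (ℕ; zero; suc; _*_; _⊓_; _⊔_)
open import Data.Bool using (Bool; true; false; _∧_; _∨_; not; if_then_else_)
open import Data.Fin using (Fin; zero; suc; _≟_)
open import Data.List using (List; []; _∷_; map; foldr; filterᵇ; length; allFin; _++_; concatMap)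
open import Data.Bool.ListAction using (all; any)
open import Data.Maybe using (Maybe; just; nothing)
open import Data.Product using (Σ; ∃; _×_; _,_)
open import Relation.Nullary using (¬_; ⌊_⌋)
open import Relation.Binary.PropositionalEquality using (_≡_; _≢_)
open import Data.List.Membership.Propositional using (_∈_)

Even : ℕ → Set
Even k = ∃ λ m → k ≡ 2 * m

PosCNF : ℕ → ℕ → Set
PosCNF k n = Fin n → List (Fin k)

PAssign : ℕ → Set
PAssign k = Fin k → Maybe Bool

setVar : ∀ {k} → PAssign k → Fin k → Bool → PAssign k
setVar σ X b Y = if ⌊ Y ≟ X ⌋ then just b else σ Y

AllSet : ∀ {k} → PAssign k → Set
AllSet σ = ∀ X → σ X ≢ nothing

Satisfies : ∀ {k n} → PosCNF k n → PAssign k → Set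
Satisfies F σ = ∀ i → ∃ λ X → X ∈ F i × σ X ≡ just true

data Player : Set where
  P1 P2 : Player

-- Player 1 sets an unset variable
-- TRUE, Player 2 sets an unset variable FALSE; when all variables are set,
-- Player 2 wins iff F evaluates to FALSE.
data P2Wins {k n : ℕ} (F : PosCNF k n) : PAssign k → Player → Set where
  finished : ∀ {σ p} → AllSet σ → ¬ Satisfies F σ → P2Wins F σ p
  p1-move  : ∀ {σ} → ¬ AllSet σ →
             (∀ X → σ X ≡ nothing → P2Wins F (setVar σ X true) P2) →
             P2Wins F σ P1
  p2-move  : ∀ {σ} → (X : Fin k) → σ X ≡ nothing →
             P2Wins F (setVar σ X false) P1 → P2Wins F σ P2

Player2Wins : ∀ {k n} → PosCNF k n → Set
Player2Wins F = P2Wins F (λ _ → nothing) P1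

-- Finite graphs: vertex type with an enumeration of all vertices,
-- decidable equality and (symmetric, loopless-irrelevant) adjacency.

record FinGraph : Set₁ where
  field
    Vtx   : Set
    verts : List Vtx
    eqV   : Vtx → Vtx → Bool
    adj   : Vtx → Vtx → Bool

module DomGame (G : FinGraph) where
  open FinGraph G

  N[_] : Vtx → Vtx → Bool
  N[ v ] u = eqV u v ∨ adj v u

  data Turn : Set where
    Dominator Staller : Turn

  other : Turn → Turn
  other Dominator = Staller
  other Staller   = Dominator

  minList : List ℕ → ℕ
  minList []       = 0
  minList (x ∷ xs) = foldr _⊓_ x xs

  maxList : List ℕ → ℕ
  maxList = foldr _⊔_ 0

  opt : Turn → List ℕ → ℕ
  opt Dominator = minList
  opt Staller   = maxList

  -- dom = S ∪ N[D] (the currently dominated vertices)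
  legal : (Vtx → Bool) → Vtx → Bool
  legal dom v = any (λ u → N[ v ] u ∧ not (dom u)) verts

  addN : (Vtx → Bool) → Vtx → (Vtx → Bool)
  addN dom v u = dom u ∨ N[ v ] u

  -- number of remaining moves under optimal play; the fuel argument is
  -- at least the number of undominated vertices (each move dominates a
  -- new vertex), so fuel never runs out before the game ends.
  value : ℕ → (Vtx → Bool) → Turn → ℕ
  value zero    dom t = 0
  value (suc f) dom t with all dom verts
  ... | true  = 0
  ... | false = suc (opt t (map (λ v → value f (addN dom v) (other t))
                                (filterᵇ (legal dom) verts)))

γg : (G : FinGraph) → (FinGraph.Vtx G → Bool) → ℕ
γg G S = DomGame.value G (length (FinGraph.verts G)) S DomGame.Dominator

data WV : Set where
  a1 a2 x x' y y' z b1 b2 : WV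

allWV : List WV
allWV = a1 ∷ a2 ∷ x ∷ x' ∷ y ∷ y' ∷ z ∷ b1 ∷ b2 ∷ []

eqWV : WV → WV → Bool
eqWV a1 a1 = true
eqWV a2 a2 = true
eqWV x  x  = true
eqWV x' x' = true
eqWV y  y  = true
eqWV y' y' = true
eqWV z  z  = true
eqWV b1 b1 = true
eqWV b2 b2 = true
eqWV _  _  = false

-- each edge listed once
wE : WV → WV → Bool
-- K6 on {a2,x,x',y,y',z} minus a2z, xx', yy'
wE a2 x  = true
wE a2 x' = true
wE a2 y  = true
wE a2 y' = true
wE x  y  = true
wE x  y' = true
wE x  z  = true
wE x' y  = true
wE x' y' = true
wE x' z  = true
wE y  z  = true
wE y' z  = true
wE b1 a1 = true
wE a1 b2 = true
wE b1 x  = true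
wE b1 x' = true
wE b2 y  = true
wE b2 y' = true
wE a1 z  = true
wE _  _  = false

wAdj : WV → WV → Bool
wAdj u v = wE u v ∨ wE v u

data V (k n : ℕ) : Set where
  w : Fin k → WV → V k n
  c : Fin n → V k n
  p : Fin 4 → V k n          -- path vertex p_1..p_4 (indices 0..3)

module _ {k n : ℕ} where

  allV : List (V k n)
  allV = concatMap (λ X → map (w X) allWV) (allFin k)
         ++ map c (allFin n) ++ map p (allFin 4)

  finEq : ∀ {m} → Fin m → Fin m → Bool
  finEq i j = ⌊ i ≟ j ⌋

  eqVk : V k n → V k n → Bool
  eqVk (w X u) (w Y v) = finEq X Y ∧ eqWV u v
  eqVk (c i)   (c j)   = finEq i j
  eqVk (p i)   (p j)   = finEq i j
  eqVk _       _       = false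

  inClause : PosCNF k n → Fin n → Fin k → Bool
  inClause F i X = any (finEq X) (F i)

  isA-w : WV → Bool
  isA-w a1 = true
  isA-w a2 = true
  isA-w _  = false

  -- one direction of the non-widget edges
  E : PosCNF k n → V k n → V k n → Bool
  E F (w X u) (w Y v) = finEq X Y ∧ wAdj u v
  E F (c i)   (w X u) = isA-w u ∧ inClause F i X
  E F (c i)   (c j)   = not (finEq i j)
  E F (p zero) (p (suc zero)) = true
  E F (p (suc zero)) (p (suc (suc zero))) = true
  E F (p (suc (suc zero))) (p (suc (suc (suc zero)))) = true
  E F (c i)   (p zero) = true
  E F (c i)   (p (suc (suc (suc zero)))) = true
  E F _ _ = false

  adjGF : PosCNF k n → V k n → V k n → Bool
  adjGF F u v = E F u v ∨ E F v u

  isA : V k n → Bool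
  isA (w X u) = isA-w u
  isA _       = false

GF : ∀ {k n} → PosCNF k n → FinGraph
GF {k} {n} F = record
  { Vtx = V k n ; verts = allV ; eqV = eqVk ; adj = adjGF F }

module Submission where

-- Staller plays against a potential Φ: each widget contributes a residual
-- (3 while untouched, 0 once dominated) and the path p₁p₂p₃p₄ contributes 2
-- while untouched, so Φ(A) = 3k + 2.  Exhaustive checks on a single widget and
-- on the path show that Staller can answer every Dominator move so that Φ drops
-- by at most 2 per round, and can always move so that it drops by at most 1.
--
-- For the extra move Staller keeps the play tight: Φ is even and she must
-- still force Φ + 1 moves.  She then mirrors the POS-CNF game: widgets of unset
-- variables have odd residual; Dominator playing a₁ or a₂ in a fresh widget, or
-- completing an undecided one, is read as Player 1 setting that variable TRUE;
-- the resulting odd potential is repaired by a move outside A in another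
-- undecided widget, which dominates no clause vertex: Player 2 setting that
-- variable FALSE, as dictated by Player 2's winning strategy (k even makes the
-- parities match).  When Φ reaches 0 the assignment falsifies some clause Cᵢ,
-- and cᵢ is still undominated.


open import Defs
open import Data.Nat using (ℕ; zero; suc; _+_; _*_; _≤_; _≤ᵇ_; z≤n; s≤s; _⊓_; _⊔_)
open import Data.Nat.Properties using (+-0-monoid; +-comm; +-assoc; +-identityʳ; +-cancelʳ-≤; +-cancelˡ-≤; +-cancelʳ-≡; +-monoʳ-≤; +-mono-≤; *-comm; *-monoˡ-≤; m+n≡0⇒m≡0; m+n≡0⇒n≡0; m≤n+m; n≤1+n; suc-injective; ≤-trans; ≤-reflexive; ≤ᵇ⇒≤; ⊓-glb; m≤m⊔n; m≤n⊔m; module ≤-Reasoning)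
open import Data.Nat.Divisibility using (_∣_; divides; _∣0; ∣-refl; ∣m∣n⇒∣m+n; ∣m+n∣m⇒∣n; ∣1⇒≡1)
open import Data.Nat.Tactic.RingSolver using (solve-∀)
open import Data.Bool using (Bool; true; false; _∧_; _∨_; not; if_then_else_; T)
open import Data.Bool.Properties using (∨-identityʳ; not-injective)
open import Data.Bool.ListAction using (all; any)
open import Data.Fin using (Fin; zero; suc; _≟_)
open import Data.Fin.Patterns using (0F; 1F; 2F; 3F)
import Data.Fin.Properties as Fin
open import Data.List using (List; []; _∷_; map; foldr; foldl; filterᵇ; allFin; concatMap; length; _++_)
open import Data.List.Properties using (length-++; length-tabulate)
open import Data.List.Membership.Propositional using (_∈_)
open import Data.List.Membership.Propositional.Properties using (∈-map⁺; ∈-++⁺ˡ; ∈-++⁺ʳ; ∈-concat⁺′; ∈-allFin)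
open import Data.List.Relation.Unary.Any using (here; there)
open import Data.Maybe using (just; nothing)
open import Data.Product using (Σ; ∃; ∃₂; _×_; _,_; proj₁; proj₂)
open import Data.Sum using (_⊎_; inj₁; inj₂; map₂)
open import Data.Empty using (⊥; ⊥-elim)
open import Data.Unit using (tt)
open import Function using (_∘_; case_of_)
open import Relation.Nullary using (yes; no)
open import Relation.Binary.PropositionalEquality using (_≡_; _≢_; refl; sym; trans; cong; cong₂; subst; subst₂; module ≡-Reasoning)
open import Algebra.Properties.Monoid.Sum +-0-monoid using (sum; sum-cong-≗)

∧-sound : ∀ {a b} → a ∧ b ≡ true → a ≡ true × b ≡ true
∧-sound {true} e = refl , e

∨-false : ∀ {a b} → b ≡ false → a ∨ b ≡ a
∨-false {a} refl = ∨-identityʳ a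

∨-false-sound : ∀ {a b} → a ∨ b ≡ true → a ≡ false → b ≡ true
∨-false-sound e refl = e

if-true-sound : ∀ {a u v} → (if a then u else v) ≡ true → a ≡ true → u ≡ true
if-true-sound e refl = e

if-false-sound : ∀ {a u v} → (if a then u else v) ≡ true → a ≡ false → v ≡ true
if-false-sound e refl = e

≤ᵇ-sound : ∀ {m n} → (m ≤ᵇ n) ≡ true → m ≤ n
≤ᵇ-sound {m} {n} e = ≤ᵇ⇒≤ m n (subst T (sym e) tt)

-- Opaque, so that `f` can be inferred from `∀-Bool f`; the exhaustive checks unfold it.
opaque
  ∀-Bool : (Bool → Bool) → Bool
  ∀-Bool f = f true ∧ f false

  ∀-Bool-sound : ∀ {f} → ∀-Bool f ≡ true → ∀ a → f a ≡ true
  ∀-Bool-sound {f} e true with f true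
  ∀-Bool-sound e true | true = refl
  ∀-Bool-sound {f} e false with f true
  ∀-Bool-sound e false | true = e

module _ {A : Set} (f : A → Bool) where

  any≡true⁺ : ∀ {u xs} → u ∈ xs → f u ≡ true → any f xs ≡ true
  any≡true⁺ (here refl) fu rewrite fu = refl
  any≡true⁺ {xs = v ∷ _} (there u∈xs) fu with f v
  ... | true  = refl
  ... | false = any≡true⁺ u∈xs fu

  any≡true⁻ : ∀ xs → any f xs ≡ true → ∃ λ u → u ∈ xs × f u ≡ true
  any≡true⁻ (v ∷ xs) e with f v in fv
  ... | true  = v , here refl , fv
  ... | false with any≡true⁻ xs e
  ...   | u , u∈xs , fu = u , there u∈xs , fu

  any≡false⁻ : ∀ {u xs} → any f xs ≡ false → u ∈ xs → f u ≡ false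
  any≡false⁻ {xs = v ∷ _} e u∈xs with f v in fv
  any≡false⁻ e (here refl) | false = fv
  any≡false⁻ e (there u∈xs) | false = any≡false⁻ e u∈xs

  all≡true⁻ : ∀ {u xs} → all f xs ≡ true → u ∈ xs → f u ≡ true
  all≡true⁻ {xs = v ∷ _} e u∈xs with f v in fv
  all≡true⁻ e (here refl) | true = fv
  all≡true⁻ e (there u∈xs) | true = all≡true⁻ e u∈xs

  all≡false⁺ : ∀ {u xs} → u ∈ xs → f u ≡ false → all f xs ≡ false
  all≡false⁺ (here refl) fu rewrite fu = refl
  all≡false⁺ {xs = v ∷ _} (there u∈xs) fu with f v
  ... | true  = all≡false⁺ u∈xs fu
  ... | false = refl

  all≡false⁻ : ∀ xs → all f xs ≡ false → ∃ λ u → u ∈ xs × f u ≡ false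
  all≡false⁻ (v ∷ xs) e with f v in fv
  ... | false = v , here refl , fv
  ... | true with all≡false⁻ xs e
  ...   | u , u∈xs , fu = u , there u∈xs , fu

module _ {A : Set} (g : A → ℕ) (q : A → Bool) {b : ℕ} where

  foldr-⊓-filter-glb : ∀ {x₀} xs → b ≤ x₀ → (∀ v → q v ≡ true → b ≤ g v) →
                       b ≤ foldr _⊓_ x₀ (map g (filterᵇ q xs))
  foldr-⊓-filter-glb []       b≤x₀ b≤g = b≤x₀
  foldr-⊓-filter-glb (v ∷ xs) b≤x₀ b≤g with q v in qv
  ... | true  = ⊓-glb (b≤g v qv) (foldr-⊓-filter-glb xs b≤x₀ b≤g)
  ... | false = foldr-⊓-filter-glb xs b≤x₀ b≤g

  foldr-⊔-filter-≥ : ∀ {u xs} → u ∈ xs → q u ≡ true → b ≤ g u →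
                     b ≤ foldr _⊔_ 0 (map g (filterᵇ q xs))
  foldr-⊔-filter-≥ {xs = v ∷ _} (here refl) qu b≤gu rewrite qu = ≤-trans b≤gu (m≤m⊔n (g v) _)
  foldr-⊔-filter-≥ {xs = v ∷ _} (there u∈xs) qu b≤gu with q v
  ... | true  = ≤-trans (foldr-⊔-filter-≥ u∈xs qu b≤gu) (m≤n⊔m (g v) _)
  ... | false = foldr-⊔-filter-≥ u∈xs qu b≤gu

sum-const : ∀ m a → sum {m} (λ _ → a) ≡ m * a
sum-const zero    a = refl
sum-const (suc m) a = cong (a +_) (sum-const m a)

sum-update : ∀ {m} (f g : Fin m → ℕ) i → (∀ j → j ≢ i → g j ≡ f j) →
             sum g + f i ≡ sum f + g i
sum-update {suc m} f g zero g≡f rewrite sum-cong-≗ (λ j → g≡f (suc j) λ ()) =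
  swap (g zero) (f zero) (sum (λ j → f (suc j)))
  where
    swap : ∀ a b d → a + d + b ≡ b + d + a
    swap = solve-∀
sum-update {suc m} f g (suc i) g≡f rewrite g≡f zero (λ ()) = begin
    f zero + sum (g ∘suc) + f (suc i)   ≡⟨ +-assoc (f zero) _ _ ⟩
    f zero + (sum (g ∘suc) + f (suc i)) ≡⟨ cong (f zero +_) (sum-update (f ∘suc) (g ∘suc) i
                                             (λ j j≢i → g≡f (suc j) (λ e → j≢i (Fin.suc-injective e)))) ⟩
    f zero + (sum (f ∘suc) + g (suc i)) ≡⟨ sym (+-assoc (f zero) _ _) ⟩
    f zero + sum (f ∘suc) + g (suc i)   ∎
  where
    open ≡-Reasoning
    _∘suc : (Fin (suc m) → ℕ) → Fin m → ℕ
    h ∘suc = λ j → h (suc j)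

sum≡0⇒≡0 : ∀ {m} (f : Fin m → ℕ) → sum f ≡ 0 → ∀ i → f i ≡ 0
sum≡0⇒≡0 f Σf≡0 zero    = m+n≡0⇒m≡0 (f zero) Σf≡0
sum≡0⇒≡0 f Σf≡0 (suc i) = sum≡0⇒≡0 (λ j → f (suc j)) (m+n≡0⇒n≡0 (f zero) Σf≡0) i

0<sum⇒∃0< : ∀ {m} (f : Fin m → ℕ) → 1 ≤ sum f → ∃ λ i → 1 ≤ f i
0<sum⇒∃0< {suc m} f 0<Σf with f zero in f₀
... | suc _ = zero , subst (1 ≤_) (sym f₀) (s≤s z≤n)
... | zero with 0<sum⇒∃0< (λ j → f (suc j)) 0<Σf
...   | i , 0<fi = suc i , 0<fi

∣-sum : ∀ {d m} (f : Fin m → ℕ) → (∀ i → d ∣ f i) → d ∣ sum f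
∣-sum {d} {zero}  f d∣f = d ∣0
∣-sum {d} {suc m} f d∣f = ∣m∣n⇒∣m+n (d∣f zero) (∣-sum (λ j → f (suc j)) (λ j → d∣f (suc j)))

2∣2+⇒2∣ : ∀ {n} → 2 ∣ 2 + n → 2 ∣ n
2∣2+⇒2∣ 2∣2+n = ∣m+n∣m⇒∣n 2∣2+n ∣-refl

2∣⇒2∤suc : ∀ {n} → 2 ∣ n → 2 ∣ suc n → ⊥
2∣⇒2∤suc {n} 2∣n 2∣1+n with () ← ∣1⇒≡1 (∣m+n∣m⇒∣n (subst (2 ∣_) (+-comm 1 n) 2∣1+n) 2∣n)

+-rotate : ∀ a b d → a + (b + d) ≡ a + d + b
+-rotate = solve-∀

+-swapʳ : ∀ a b d → a + b + d ≡ a + d + b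
+-swapʳ = solve-∀

-- Balance equations `a′ + r ≡ a + r′` record that a quantity a changed to a′
-- exactly as some r changed to r′, without truncated subtraction.
balance-≤ : ∀ {a a′ r r′ d} → a′ + r ≡ a + r′ → r ≤ r′ + d → a ≤ a′ + d
balance-≤ {a} {a′} {r} {r′} {d} bal r≤ = +-cancelʳ-≤ r′ a (a′ + d) (begin
    a + r′        ≡⟨ sym bal ⟩
    a′ + r        ≤⟨ +-monoʳ-≤ a′ r≤ ⟩
    a′ + (r′ + d) ≡⟨ +-rotate a′ r′ d ⟩
    a′ + d + r′   ∎)
  where open ≤-Reasoning

balance-≡ : ∀ {a a′ r r′ d} → a′ + r ≡ a + r′ → r ≡ r′ + d → a ≡ a′ + d
balance-≡ {a} {a′} {r} {r′} {d} bal r≡ = +-cancelʳ-≡ r′ a (a′ + d) (begin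
    a + r′        ≡⟨ sym bal ⟩
    a′ + r        ≡⟨ cong (a′ +_) r≡ ⟩
    a′ + (r′ + d) ≡⟨ +-rotate a′ r′ d ⟩
    a′ + d + r′   ∎)
  where open ≡-Reasoning

balance-trans : ∀ {a a′ a″ r r′ r″} → a′ + r ≡ a + r′ → a″ + r′ ≡ a′ + r″ → a″ + r ≡ a + r″
balance-trans {a} {a′} {a″} {r} {r′} {r″} bal bal′ = +-cancelʳ-≡ r′ (a″ + r) (a + r″) (begin
    a″ + r + r′   ≡⟨ +-swapʳ a″ r r′ ⟩
    a″ + r′ + r   ≡⟨ cong (_+ r) bal′ ⟩
    a′ + r″ + r   ≡⟨ +-swapʳ a′ r″ r ⟩
    a′ + r + r″   ≡⟨ cong (_+ r″) bal ⟩
    a + r′ + r″   ≡⟨ +-swapʳ a r′ r″ ⟩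
    a + r″ + r′   ∎)
  where open ≡-Reasoning

balance-+ : ∀ {a a′ r r′} s → a′ + r ≡ a + r′ → a′ + s + r ≡ a + s + r′
balance-+ {a} {a′} {r} {r′} s bal = begin
    a′ + s + r   ≡⟨ +-swapʳ a′ s r ⟩
    a′ + r + s   ≡⟨ cong (_+ s) bal ⟩
    a + r′ + s   ≡⟨ +-swapʳ a r′ s ⟩
    a + s + r′   ∎
  where open ≡-Reasoning

+-≤-cancel : ∀ d {m a b} → d + m ≤ a → a ≤ b + d → m ≤ b
+-≤-cancel d {m} {a} {b} d+m≤a a≤b+d = +-cancelˡ-≤ d m b (≤-trans d+m≤a (subst (a ≤_) (+-comm b d) a≤b+d))

balance-≤′ : ∀ {a a′ r r′} → a′ + r ≡ a + r′ → r ≤ r′ → a ≤ a′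
balance-≤′ {a} {a′} {r} {r′} bal r≤r′ =
  subst (a ≤_) (+-identityʳ a′) (balance-≤ bal (subst (r ≤_) (sym (+-identityʳ r′)) r≤r′))

balance-suc : ∀ {a a′ r r′} → a′ + r ≡ a + r′ → r ≡ suc r′ → a ≡ suc a′
balance-suc {a} {a′} {r} {r′} bal r≡1+r′ = trans (balance-≡ bal (trans r≡1+r′ (+-comm 1 r′))) (+-comm a′ 1)

-- A Staller strategy is given by an invariant `Secures m dom`, read "from the
-- position dom with Dominator to move, Staller can force m more moves".
module StallerLowerBound (G : FinGraph)
  (eqV-refl : ∀ u → FinGraph.eqV G u u ≡ true)
  (verts-complete : ∀ u → u ∈ FinGraph.verts G) where

  open FinGraph G
  open DomGame G

  record StallerInvariant : Set₁ where
    field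
      Secures    : ℕ → (Vtx → Bool) → Set
      unfinished : ∀ {m dom} → Secures (suc m) dom → ∃ λ u → dom u ≡ false
      reply      : ∀ {m dom v} → Secures (suc (suc m)) dom → legal dom v ≡ true →
                   ∃ λ u → legal (addN dom v) u ≡ true × Secures m (addN (addN dom v) u)

  undominated-legal : ∀ {dom u} → dom u ≡ false → legal dom u ≡ true
  undominated-legal {dom} {u} du = any≡true⁺ _ (verts-complete u) self-undominated
    where
      self-undominated : (eqV u u ∨ adj u u) ∧ not (dom u) ≡ true
      self-undominated rewrite eqV-refl u | du = refl

  legal⇒unfinished : ∀ {dom v} → legal dom v ≡ true → all dom verts ≡ false
  legal⇒unfinished {dom} lv with any≡true⁻ _ verts lv
  ... | u , u∈verts , h = all≡false⁺ dom u∈verts (not-injective (proj₂ (∧-sound h)))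

  value-unfold : ∀ f dom t → all dom verts ≡ false →
    value (suc f) dom t ≡ suc (opt t (map (λ v → value f (addN dom v) (other t)) (filterᵇ (legal dom) verts)))
  value-unfold f dom t unfinished rewrite unfinished = refl

  minList-filter-glb : ∀ {A : Set} (g : A → ℕ) (q : A → Bool) {b} xs →
                       (∀ v → q v ≡ true → b ≤ g v) → any q xs ≡ true →
                       b ≤ minList (map g (filterᵇ q xs))
  minList-filter-glb g q (v ∷ xs) b≤g some-q with q v in qv
  ... | true  = foldr-⊓-filter-glb g q xs (b≤g v qv) b≤g
  ... | false = minList-filter-glb g q xs b≤g some-q

  module _ (I : StallerInvariant) where
    open StallerInvariant I

    mutual
      value-≥ : ∀ f m dom → m ≤ f → Secures m dom → m ≤ value f dom Dominator
      value-≥ f zero dom _ _ = z≤n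
      value-≥ (suc f) (suc m) dom (s≤s m≤f) sec with unfinished sec
      ... | u , du rewrite value-unfold f dom Dominator (all≡false⁺ dom (verts-complete u) du) =
            s≤s (minList-filter-glb (λ v → value f (addN dom v) Staller) (legal dom) verts
                   (λ v lv → value-after-Dominator f m dom v m≤f sec lv)
                   (any≡true⁺ (legal dom) (verts-complete u) (undominated-legal du)))

      value-after-Dominator : ∀ f m dom v → m ≤ f → Secures (suc m) dom → legal dom v ≡ true →
                              m ≤ value f (addN dom v) Staller
      value-after-Dominator f zero dom v _ _ _ = z≤n
      value-after-Dominator (suc f) (suc m) dom v (s≤s m≤f) sec lv with reply sec lv
      ... | u , lu , sec′ rewrite value-unfold f (addN dom v) Staller (legal⇒unfinished lu) =
            s≤s (foldr-⊔-filter-≥ _ (legal (addN dom v)) (verts-complete u) lu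
                   (value-≥ f m (addN (addN dom v) u) m≤f sec′))

-- Shaped like N[ w X t ] (w X s) in G_F, so that the two agree once finEq X X is rewritten.
N[_]ᵂ : WV → WV → Bool
N[ t ]ᵂ s = eqWV s t ∨ (wAdj t s ∨ wAdj s t)

-- Which of the widget vertices outside A are dominated, in the order x x' y y' z b₁ b₂.
data WidgetState : Set where
  state : (dx dx' dy dy' dz db₁ db₂ : Bool) → WidgetState

outsideA : List WV
outsideA = x ∷ x' ∷ y ∷ y' ∷ z ∷ b1 ∷ b2 ∷ []

dominatedᵂ : WidgetState → WV → Bool
dominatedᵂ (state dx dx' dy dy' dz db₁ db₂) x  = dx
dominatedᵂ (state dx dx' dy dy' dz db₁ db₂) x' = dx'
dominatedᵂ (state dx dx' dy dy' dz db₁ db₂) y  = dy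
dominatedᵂ (state dx dx' dy dy' dz db₁ db₂) y' = dy'
dominatedᵂ (state dx dx' dy dy' dz db₁ db₂) z  = dz
dominatedᵂ (state dx dx' dy dy' dz db₁ db₂) b1 = db₁
dominatedᵂ (state dx dx' dy dy' dz db₁ db₂) b2 = db₂
dominatedᵂ _ a1 = true
dominatedᵂ _ a2 = true

playᵂ : WidgetState → WV → WidgetState
playᵂ (state dx dx' dy dy' dz db₁ db₂) t =
  state (dx ∨ N[ t ]ᵂ x) (dx' ∨ N[ t ]ᵂ x') (dy ∨ N[ t ]ᵂ y) (dy' ∨ N[ t ]ᵂ y')
        (dz ∨ N[ t ]ᵂ z) (db₁ ∨ N[ t ]ᵂ b1) (db₂ ∨ N[ t ]ᵂ b2)

opaque
  ∀-WidgetState : (WidgetState → Bool) → Bool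
  ∀-WidgetState q = ∀-Bool λ u₁ → ∀-Bool λ u₂ → ∀-Bool λ u₃ → ∀-Bool λ u₄ →
                    ∀-Bool λ u₅ → ∀-Bool λ u₆ → ∀-Bool λ u₇ → q (state u₁ u₂ u₃ u₄ u₅ u₆ u₇)

  ∀-WidgetState-sound : ∀ {q} → ∀-WidgetState q ≡ true → ∀ s → q s ≡ true
  ∀-WidgetState-sound e (state u₁ u₂ u₃ u₄ u₅ u₆ u₇) =
    ∀-Bool-sound (∀-Bool-sound (∀-Bool-sound (∀-Bool-sound (∀-Bool-sound (∀-Bool-sound
      (∀-Bool-sound e u₁) u₂) u₃) u₄) u₅) u₆) u₇

allWV-complete : ∀ t → t ∈ allWV
allWV-complete a1 = here refl
allWV-complete a2 = there (here refl)
allWV-complete x  = there (there (here refl))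
allWV-complete x' = there (there (there (here refl)))
allWV-complete y  = there (there (there (there (here refl))))
allWV-complete y' = there (there (there (there (there (here refl)))))
allWV-complete z  = there (there (there (there (there (there (here refl))))))
allWV-complete b1 = there (there (there (there (there (there (there (here refl)))))))
allWV-complete b2 = there (there (there (there (there (there (there (there (here refl))))))))

opaque
  ∀-WV : (WV → Bool) → Bool
  ∀-WV f = all f allWV

  ∀-WV-sound : ∀ {f} → ∀-WV f ≡ true → ∀ t → f t ≡ true
  ∀-WV-sound {f} e t = all≡true⁻ f e (allWV-complete t)

opaque
  legalᵂ : WidgetState → WV → Bool
  legalᵂ b r = any (λ s → N[ r ]ᵂ s ∧ not (dominatedᵂ b s)) outsideA

  finishedᵂ : WidgetState → Bool
  finishedᵂ b = all (dominatedᵂ b) outsideA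

  oneMoveFinishesᵂ : WidgetState → Bool
  oneMoveFinishesᵂ b = any (λ v → all (λ s → dominatedᵂ b s ∨ N[ v ]ᵂ s) outsideA) allWV

  untouchedᵂ : WidgetState → Bool
  untouchedᵂ b = all (not ∘ dominatedᵂ b) outsideA

  -- A widget's contribution to the potential that bounds the rest of the game from below.
  residualᵂ : WidgetState → ℕ
  residualᵂ b = if finishedᵂ b then 0 else if oneMoveFinishesᵂ b then 1
                else if untouchedᵂ b then 3 else 2

  stallerReplyᵂ : WidgetState → WV
  stallerReplyᵂ b = foldl better a1 allWV
    where better : WV → WV → WV
          better r r′ = if legalᵂ b r′ ∧ (not (legalᵂ b r) ∨ (residualᵂ (playᵂ b r) ≤ᵇ residualᵂ (playᵂ b r′)))
                        then r′ else r

opaque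
  unfolding legalᵂ finishedᵂ

  legalᵂ⁻ : ∀ {b r} → legalᵂ b r ≡ true → ∃ λ s → s ∈ outsideA × N[ r ]ᵂ s ∧ not (dominatedᵂ b s) ≡ true
  legalᵂ⁻ = any≡true⁻ _ outsideA

  finishedᵂ⁻ : ∀ {b} → finishedᵂ b ≡ false → ∃ λ s → s ∈ outsideA × dominatedᵂ b s ≡ false
  finishedᵂ⁻ = all≡false⁻ _ outsideA

opaque
  unfolding ∀-Bool ∀-WidgetState ∀-WV legalᵂ finishedᵂ oneMoveFinishesᵂ untouchedᵂ residualᵂ stallerReplyᵂ

  residualᵂ-finished : ∀ {b} → finishedᵂ b ≡ true → residualᵂ b ≡ 0
  residualᵂ-finished fin rewrite fin = refl

  residualᵂ-unfinished : ∀ {b} → finishedᵂ b ≡ false → 1 ≤ residualᵂ b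
  residualᵂ-unfinished {b} fin rewrite fin with oneMoveFinishesᵂ b
  ... | true = s≤s z≤n
  ... | false with untouchedᵂ b
  ...   | true  = s≤s z≤n
  ...   | false = s≤s z≤n

  reply-check : ∀-WidgetState (λ b → ∀-WV λ t →
                  if finishedᵂ (playᵂ b t) then residualᵂ b ≤ᵇ 1
                  else legalᵂ (playᵂ b t) (stallerReplyᵂ (playᵂ b t)) ∧
                       (residualᵂ b ≤ᵇ residualᵂ (playᵂ (playᵂ b t) (stallerReplyᵂ (playᵂ b t))) + 2)) ≡ true
  reply-check = refl

  move-check : ∀-WidgetState (λ b → finishedᵂ b ∨
                  (legalᵂ b (stallerReplyᵂ b) ∧ (residualᵂ b ≤ᵇ residualᵂ (playᵂ b (stallerReplyᵂ b)) + 1))) ≡ true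
  move-check = refl

residualᵂ-reply : ∀ b t →
  (finishedᵂ (playᵂ b t) ≡ true × residualᵂ b ≤ 1) ⊎
  ∃ λ r → legalᵂ (playᵂ b t) r ≡ true × residualᵂ b ≤ residualᵂ (playᵂ (playᵂ b t) r) + 2
residualᵂ-reply b t with finishedᵂ (playᵂ b t) in fin
... | true  = inj₁ (refl , ≤ᵇ-sound (if-true-sound ok fin))
  where ok = ∀-WV-sound (∀-WidgetState-sound reply-check b) t
... | false = let legal , bound = ∧-sound (if-false-sound ok fin) in inj₂ (_ , legal , ≤ᵇ-sound bound)
  where ok = ∀-WV-sound (∀-WidgetState-sound reply-check b) t

residualᵂ-move : ∀ b → finishedᵂ b ≡ false →
                 ∃ λ r → legalᵂ b r ≡ true × residualᵂ b ≤ residualᵂ (playᵂ b r) + 1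
residualᵂ-move b unfinished =
  let legal , bound = ∧-sound (∨-false-sound (∀-WidgetState-sound move-check b) unfinished)
  in _ , legal , ≤ᵇ-sound bound

-- Any clause vertex c_i acts on the path like a vertex adjacent to p₁ and p₄.
data PathMove : Set where
  clause : PathMove
  vertex : Fin 4 → PathMove

N[_]ᴾ : PathMove → Fin 4 → Bool
N[ clause    ]ᴾ 0F = true
N[ clause    ]ᴾ 3F = true
N[ vertex 0F ]ᴾ 0F = true
N[ vertex 0F ]ᴾ 1F = true
N[ vertex 1F ]ᴾ 0F = true
N[ vertex 1F ]ᴾ 1F = true
N[ vertex 1F ]ᴾ 2F = true
N[ vertex 2F ]ᴾ 1F = true
N[ vertex 2F ]ᴾ 2F = true
N[ vertex 2F ]ᴾ 3F = true
N[ vertex 3F ]ᴾ 2F = true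
N[ vertex 3F ]ᴾ 3F = true
N[ _ ]ᴾ _ = false

data PathState : Set where
  path : (d₁ d₂ d₃ d₄ : Bool) → PathState

dominatedᴾ : PathState → Fin 4 → Bool
dominatedᴾ (path d₁ d₂ d₃ d₄) 0F = d₁
dominatedᴾ (path d₁ d₂ d₃ d₄) 1F = d₂
dominatedᴾ (path d₁ d₂ d₃ d₄) 2F = d₃
dominatedᴾ (path d₁ d₂ d₃ d₄) 3F = d₄

playᴾ : PathState → PathMove → PathState
playᴾ (path d₁ d₂ d₃ d₄) m = path (d₁ ∨ N[ m ]ᴾ 0F) (d₂ ∨ N[ m ]ᴾ 1F) (d₃ ∨ N[ m ]ᴾ 2F) (d₄ ∨ N[ m ]ᴾ 3F)

pathVertices : List (Fin 4)
pathVertices = 0F ∷ 1F ∷ 2F ∷ 3F ∷ []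

pathMoves : List PathMove
pathMoves = clause ∷ vertex 0F ∷ vertex 1F ∷ vertex 2F ∷ vertex 3F ∷ []

pathMoves-complete : ∀ m → m ∈ pathMoves
pathMoves-complete clause      = here refl
pathMoves-complete (vertex 0F) = there (here refl)
pathMoves-complete (vertex 1F) = there (there (here refl))
pathMoves-complete (vertex 2F) = there (there (there (here refl)))
pathMoves-complete (vertex 3F) = there (there (there (there (here refl))))

opaque
  ∀-PathState : (PathState → Bool) → Bool
  ∀-PathState q = ∀-Bool λ u₁ → ∀-Bool λ u₂ → ∀-Bool λ u₃ → ∀-Bool λ u₄ → q (path u₁ u₂ u₃ u₄)

  ∀-PathState-sound : ∀ {q} → ∀-PathState q ≡ true → ∀ s → q s ≡ true
  ∀-PathState-sound e (path u₁ u₂ u₃ u₄) =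
    ∀-Bool-sound (∀-Bool-sound (∀-Bool-sound (∀-Bool-sound e u₁) u₂) u₃) u₄

  ∀-PathMove : (PathMove → Bool) → Bool
  ∀-PathMove f = all f pathMoves

  ∀-PathMove-sound : ∀ {f} → ∀-PathMove f ≡ true → ∀ m → f m ≡ true
  ∀-PathMove-sound {f} e m = all≡true⁻ f e (pathMoves-complete m)

opaque
  legalᴾ : PathState → PathMove → Bool
  legalᴾ b m = any (λ j → N[ m ]ᴾ j ∧ not (dominatedᴾ b j)) pathVertices

  finishedᴾ : PathState → Bool
  finishedᴾ b = all (dominatedᴾ b) pathVertices

  oneMoveFinishesᴾ : PathState → Bool
  oneMoveFinishesᴾ b = any (λ m → all (λ j → dominatedᴾ b j ∨ N[ m ]ᴾ j) pathVertices) pathMoves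

  residualᴾ : PathState → ℕ
  residualᴾ b = if finishedᴾ b then 0 else if oneMoveFinishesᴾ b then 1 else 2

  stallerReplyᴾ : PathState → Fin 4
  stallerReplyᴾ b = foldl better 0F pathVertices
    where better : Fin 4 → Fin 4 → Fin 4
          better r r′ = if legalᴾ b (vertex r′) ∧ (not (legalᴾ b (vertex r)) ∨
                             (residualᴾ (playᴾ b (vertex r)) ≤ᵇ residualᴾ (playᴾ b (vertex r′))))
                        then r′ else r

opaque
  unfolding legalᴾ finishedᴾ

  legalᴾ⁻ : ∀ {b m} → legalᴾ b m ≡ true → ∃ λ j → N[ m ]ᴾ j ∧ not (dominatedᴾ b j) ≡ true
  legalᴾ⁻ e with any≡true⁻ _ pathVertices e
  ... | j , _ , h = j , h

  finishedᴾ⁻ : ∀ {b} → finishedᴾ b ≡ false → ∃ λ j → dominatedᴾ b j ≡ false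
  finishedᴾ⁻ e with all≡false⁻ _ pathVertices e
  ... | j , _ , h = j , h

opaque
  unfolding ∀-Bool ∀-PathState ∀-PathMove legalᴾ finishedᴾ oneMoveFinishesᴾ residualᴾ stallerReplyᴾ

  residualᴾ-finished : ∀ {b} → finishedᴾ b ≡ true → residualᴾ b ≡ 0
  residualᴾ-finished fin rewrite fin = refl

  residualᴾ-unfinished : ∀ {b} → finishedᴾ b ≡ false → 1 ≤ residualᴾ b
  residualᴾ-unfinished {b} fin rewrite fin with oneMoveFinishesᴾ b
  ... | true  = s≤s z≤n
  ... | false = s≤s z≤n

  path-reply-check : ∀-PathState (λ b → ∀-PathMove λ m →
                       if finishedᴾ (playᴾ b m) then residualᴾ b ≤ᵇ 1
                       else legalᴾ (playᴾ b m) (vertex (stallerReplyᴾ (playᴾ b m))) ∧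
                            (residualᴾ b ≤ᵇ residualᴾ (playᴾ (playᴾ b m) (vertex (stallerReplyᴾ (playᴾ b m)))) + 2)) ≡ true
  path-reply-check = refl

  path-move-check : ∀-PathState (λ b → finishedᴾ b ∨
                      (legalᴾ b (vertex (stallerReplyᴾ b)) ∧
                       (residualᴾ b ≤ᵇ residualᴾ (playᴾ b (vertex (stallerReplyᴾ b))) + 1))) ≡ true
  path-move-check = refl

residualᴾ-reply : ∀ b m →
  (finishedᴾ (playᴾ b m) ≡ true × residualᴾ b ≤ 1) ⊎
  ∃ λ r → legalᴾ (playᴾ b m) (vertex r) ≡ true × residualᴾ b ≤ residualᴾ (playᴾ (playᴾ b m) (vertex r)) + 2
residualᴾ-reply b m with finishedᴾ (playᴾ b m) in fin
... | true  = inj₁ (refl , ≤ᵇ-sound (if-true-sound ok fin))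
  where ok = ∀-PathMove-sound (∀-PathState-sound path-reply-check b) m
... | false = let legal , bound = ∧-sound (if-false-sound ok fin) in inj₂ (_ , legal , ≤ᵇ-sound bound)
  where ok = ∀-PathMove-sound (∀-PathState-sound path-reply-check b) m

residualᴾ-move : ∀ b → finishedᴾ b ≡ false →
                 ∃ λ r → legalᴾ b (vertex r) ≡ true × residualᴾ b ≤ residualᴾ (playᴾ b (vertex r)) + 1
residualᴾ-move b unfinished =
  let legal , bound = ∧-sound (∨-false-sound (∀-PathState-sound path-move-check b) unfinished)
  in _ , legal , ≤ᵇ-sound bound

inAᵂ : WV → Bool
inAᵂ a1 = true
inAᵂ a2 = true
inAᵂ _  = false

-- The widget states that occur while Staller follows her strategy tightly
-- (dominated vertices listed in the order x x' y y' z b₁ b₂).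
data Normalᵂ : WidgetState → Set where
  fresh   : Normalᵂ (state false false false false false false false)
  half-x  : Normalᵂ (state true  true  false false false true  false)
  half-y  : Normalᵂ (state false false true  true  false false true )
  only-x  : Normalᵂ (state false true  true  true  true  true  true )
  only-x' : Normalᵂ (state true  false true  true  true  true  true )
  only-y  : Normalᵂ (state true  true  false true  true  true  true )
  only-y' : Normalᵂ (state true  true  true  false true  true  true )
  only-z  : Normalᵂ (state true  true  true  true  false true  true )
  only-b₁ : Normalᵂ (state true  true  true  true  true  false true )
  only-b₂ : Normalᵂ (state true  true  true  true  true  true  false)
  split-y : Normalᵂ (state true  true  false false true  true  true )
  split-z : Normalᵂ (state true  true  true  true  false true  false)
  done    : Normalᵂ (state true  true  true  true  true  true  true )

-- Widgets of unset variables.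
undecided : WidgetState → Bool
undecided (state false false false false false false false) = true
undecided (state false true  true  true  true  true  true ) = true
undecided (state true  false true  true  true  true  true ) = true
undecided (state true  true  false true  true  true  true ) = true
undecided (state true  true  true  false true  true  true ) = true
undecided (state true  true  true  true  false true  true ) = true
undecided (state true  true  true  true  true  false true ) = true
undecided (state true  true  true  true  true  true  false) = true
undecided _ = false

-- Widgets of variables Player 1 has just set TRUE, awaiting Player 2's answer.
split : WidgetState → Bool
split (state true true false false true  true true ) = true
split (state true true true  true  false true false) = true
split _ = false

data Answerᵂ (b : WidgetState) (t : WV) : Set where
  -- Dominator played a₁ or a₂ in a fresh widget: Player 1 sets the variable TRUE.
  sets-true          : (r : WV) → Normalᵂ (playᵂ (playᵂ b t) r) → legalᵂ (playᵂ b t) r ≡ true →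
                       split (playᵂ (playᵂ b t) r) ≡ true → undecided (playᵂ (playᵂ b t) r) ≡ false →
                       undecided b ≡ true → residualᵂ b ≡ residualᵂ (playᵂ (playᵂ b t) r) + 2 →
                       inAᵂ r ≡ false → Answerᵂ b t
  mirrors            : (r : WV) → Normalᵂ (playᵂ (playᵂ b t) r) → legalᵂ (playᵂ b t) r ≡ true →
                       undecided (playᵂ (playᵂ b t) r) ≡ undecided b → split (playᵂ (playᵂ b t) r) ≡ split b →
                       inAᵂ t ≡ false → inAᵂ r ≡ false →
                       residualᵂ b ≡ residualᵂ (playᵂ (playᵂ b t) r) + 2 → Answerᵂ b t
  finishes-undecided : Normalᵂ (playᵂ b t) → undecided b ≡ true → undecided (playᵂ b t) ≡ false →
                       split (playᵂ b t) ≡ false → residualᵂ b ≡ suc (residualᵂ (playᵂ b t)) → Answerᵂ b t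
  finishes-split     : Normalᵂ (playᵂ b t) → split b ≡ true → undecided (playᵂ b t) ≡ false →
                       split (playᵂ b t) ≡ false → residualᵂ b ≡ suc (residualᵂ (playᵂ b t)) → Answerᵂ b t
  concedes           : (r : WV) → legalᵂ (playᵂ b t) r ≡ true →
                       residualᵂ b ≤ residualᵂ (playᵂ (playᵂ b t) r) + 1 → Answerᵂ b t
  wastes             : residualᵂ b ≤ residualᵂ (playᵂ b t) → Answerᵂ b t

-- Player 2 setting the variable FALSE: a move outside A, so no clause vertex becomes dominated.
record Falsificationᵂ (b : WidgetState) : Set where
  constructor falsify
  field
    move      : WV
    normal    : Normalᵂ (playᵂ b move)
    legal     : legalᵂ b move ≡ true
    decided   : undecided (playᵂ b move) ≡ false
    unsplit   : split (playᵂ b move) ≡ false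
    residual  : residualᵂ b ≡ suc (residualᵂ (playᵂ b move))
    outside-A : inAᵂ move ≡ false

opaque
  unfolding legalᵂ finishedᵂ oneMoveFinishesᵂ untouchedᵂ residualᵂ

  residualᵂ-fresh : residualᵂ (state false false false false false false false) ≡ 3
  residualᵂ-fresh = refl

  answerᵂ : ∀ {b} → Normalᵂ b → (t : WV) → Answerᵂ b t
  answerᵂ fresh   a1 = sets-true b1 split-y refl refl refl refl refl refl
  answerᵂ fresh   a2 = sets-true b1 split-z refl refl refl refl refl refl
  answerᵂ fresh   x  = mirrors x' only-b₂ refl refl refl refl refl refl
  answerᵂ fresh   x' = mirrors x only-b₂ refl refl refl refl refl refl
  answerᵂ fresh   y  = mirrors y' only-b₁ refl refl refl refl refl refl
  answerᵂ fresh   y' = mirrors y only-b₁ refl refl refl refl refl refl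
  answerᵂ fresh   z  = mirrors x only-b₂ refl refl refl refl refl refl
  answerᵂ fresh   b1 = mirrors x only-b₂ refl refl refl refl refl refl
  answerᵂ fresh   b2 = mirrors x only-x' refl refl refl refl refl refl
  answerᵂ half-x  a1 = concedes y refl (≤ᵇ-sound refl)
  answerᵂ half-x  a2 = concedes x refl (≤ᵇ-sound refl)
  answerᵂ half-x  x  = mirrors y done refl refl refl refl refl refl
  answerᵂ half-x  x' = mirrors y done refl refl refl refl refl refl
  answerᵂ half-x  y  = mirrors x done refl refl refl refl refl refl
  answerᵂ half-x  y' = mirrors x done refl refl refl refl refl refl
  answerᵂ half-x  z  = mirrors y done refl refl refl refl refl refl
  answerᵂ half-x  b1 = wastes (≤ᵇ-sound refl)
  answerᵂ half-x  b2 = mirrors x done refl refl refl refl refl refl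
  answerᵂ half-y  a1 = concedes x refl (≤ᵇ-sound refl)
  answerᵂ half-y  a2 = concedes y refl (≤ᵇ-sound refl)
  answerᵂ half-y  x  = mirrors x' done refl refl refl refl refl refl
  answerᵂ half-y  x' = mirrors x done refl refl refl refl refl refl
  answerᵂ half-y  y  = mirrors x done refl refl refl refl refl refl
  answerᵂ half-y  y' = mirrors x done refl refl refl refl refl refl
  answerᵂ half-y  z  = mirrors x done refl refl refl refl refl refl
  answerᵂ half-y  b1 = mirrors x done refl refl refl refl refl refl
  answerᵂ half-y  b2 = wastes (≤ᵇ-sound refl)
  answerᵂ only-x  a1 = wastes (≤ᵇ-sound refl)
  answerᵂ only-x  a2 = finishes-undecided done refl refl refl refl
  answerᵂ only-x  x  = finishes-undecided done refl refl refl refl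
  answerᵂ only-x  x' = wastes (≤ᵇ-sound refl)
  answerᵂ only-x  y  = finishes-undecided done refl refl refl refl
  answerᵂ only-x  y' = finishes-undecided done refl refl refl refl
  answerᵂ only-x  z  = finishes-undecided done refl refl refl refl
  answerᵂ only-x  b1 = finishes-undecided done refl refl refl refl
  answerᵂ only-x  b2 = wastes (≤ᵇ-sound refl)
  answerᵂ only-x' a1 = wastes (≤ᵇ-sound refl)
  answerᵂ only-x' a2 = finishes-undecided done refl refl refl refl
  answerᵂ only-x' x  = wastes (≤ᵇ-sound refl)
  answerᵂ only-x' x' = finishes-undecided done refl refl refl refl
  answerᵂ only-x' y  = finishes-undecided done refl refl refl refl
  answerᵂ only-x' y' = finishes-undecided done refl refl refl refl
  answerᵂ only-x' z  = finishes-undecided done refl refl refl refl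
  answerᵂ only-x' b1 = finishes-undecided done refl refl refl refl
  answerᵂ only-x' b2 = wastes (≤ᵇ-sound refl)
  answerᵂ only-y  a1 = wastes (≤ᵇ-sound refl)
  answerᵂ only-y  a2 = finishes-undecided done refl refl refl refl
  answerᵂ only-y  x  = finishes-undecided done refl refl refl refl
  answerᵂ only-y  x' = finishes-undecided done refl refl refl refl
  answerᵂ only-y  y  = finishes-undecided done refl refl refl refl
  answerᵂ only-y  y' = wastes (≤ᵇ-sound refl)
  answerᵂ only-y  z  = finishes-undecided done refl refl refl refl
  answerᵂ only-y  b1 = wastes (≤ᵇ-sound refl)
  answerᵂ only-y  b2 = finishes-undecided done refl refl refl refl
  answerᵂ only-y' a1 = wastes (≤ᵇ-sound refl)
  answerᵂ only-y' a2 = finishes-undecided done refl refl refl refl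
  answerᵂ only-y' x  = finishes-undecided done refl refl refl refl
  answerᵂ only-y' x' = finishes-undecided done refl refl refl refl
  answerᵂ only-y' y  = wastes (≤ᵇ-sound refl)
  answerᵂ only-y' y' = finishes-undecided done refl refl refl refl
  answerᵂ only-y' z  = finishes-undecided done refl refl refl refl
  answerᵂ only-y' b1 = wastes (≤ᵇ-sound refl)
  answerᵂ only-y' b2 = finishes-undecided done refl refl refl refl
  answerᵂ only-z  a1 = finishes-undecided done refl refl refl refl
  answerᵂ only-z  a2 = wastes (≤ᵇ-sound refl)
  answerᵂ only-z  x  = finishes-undecided done refl refl refl refl
  answerᵂ only-z  x' = finishes-undecided done refl refl refl refl
  answerᵂ only-z  y  = finishes-undecided done refl refl refl refl
  answerᵂ only-z  y' = finishes-undecided done refl refl refl refl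
  answerᵂ only-z  z  = finishes-undecided done refl refl refl refl
  answerᵂ only-z  b1 = wastes (≤ᵇ-sound refl)
  answerᵂ only-z  b2 = wastes (≤ᵇ-sound refl)
  answerᵂ only-b₁ a1 = finishes-undecided done refl refl refl refl
  answerᵂ only-b₁ a2 = wastes (≤ᵇ-sound refl)
  answerᵂ only-b₁ x  = finishes-undecided done refl refl refl refl
  answerᵂ only-b₁ x' = finishes-undecided done refl refl refl refl
  answerᵂ only-b₁ y  = wastes (≤ᵇ-sound refl)
  answerᵂ only-b₁ y' = wastes (≤ᵇ-sound refl)
  answerᵂ only-b₁ z  = wastes (≤ᵇ-sound refl)
  answerᵂ only-b₁ b1 = finishes-undecided done refl refl refl refl
  answerᵂ only-b₁ b2 = wastes (≤ᵇ-sound refl)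
  answerᵂ only-b₂ a1 = finishes-undecided done refl refl refl refl
  answerᵂ only-b₂ a2 = wastes (≤ᵇ-sound refl)
  answerᵂ only-b₂ x  = wastes (≤ᵇ-sound refl)
  answerᵂ only-b₂ x' = wastes (≤ᵇ-sound refl)
  answerᵂ only-b₂ y  = finishes-undecided done refl refl refl refl
  answerᵂ only-b₂ y' = finishes-undecided done refl refl refl refl
  answerᵂ only-b₂ z  = wastes (≤ᵇ-sound refl)
  answerᵂ only-b₂ b1 = wastes (≤ᵇ-sound refl)
  answerᵂ only-b₂ b2 = finishes-undecided done refl refl refl refl
  answerᵂ split-y a1 = wastes (≤ᵇ-sound refl)
  answerᵂ split-y a2 = finishes-split done refl refl refl refl
  answerᵂ split-y x  = finishes-split done refl refl refl refl
  answerᵂ split-y x' = finishes-split done refl refl refl refl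
  answerᵂ split-y y  = wastes (≤ᵇ-sound refl)
  answerᵂ split-y y' = wastes (≤ᵇ-sound refl)
  answerᵂ split-y z  = finishes-split done refl refl refl refl
  answerᵂ split-y b1 = wastes (≤ᵇ-sound refl)
  answerᵂ split-y b2 = finishes-split done refl refl refl refl
  answerᵂ split-z a1 = finishes-split done refl refl refl refl
  answerᵂ split-z a2 = wastes (≤ᵇ-sound refl)
  answerᵂ split-z x  = wastes (≤ᵇ-sound refl)
  answerᵂ split-z x' = wastes (≤ᵇ-sound refl)
  answerᵂ split-z y  = finishes-split done refl refl refl refl
  answerᵂ split-z y' = finishes-split done refl refl refl refl
  answerᵂ split-z z  = wastes (≤ᵇ-sound refl)
  answerᵂ split-z b1 = wastes (≤ᵇ-sound refl)
  answerᵂ split-z b2 = wastes (≤ᵇ-sound refl)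
  answerᵂ done    _  = wastes (≤ᵇ-sound refl)

  falsificationᵂ : ∀ {b} → Normalᵂ b → undecided b ≡ true → Falsificationᵂ b
  falsificationᵂ fresh   _ = falsify b1 half-x refl refl refl refl refl
  falsificationᵂ only-x  _ = falsify x  done refl refl refl refl refl
  falsificationᵂ only-x' _ = falsify x' done refl refl refl refl refl
  falsificationᵂ only-y  _ = falsify y  done refl refl refl refl refl
  falsificationᵂ only-y' _ = falsify y' done refl refl refl refl refl
  falsificationᵂ only-z  _ = falsify z  done refl refl refl refl refl
  falsificationᵂ only-b₁ _ = falsify b1 done refl refl refl refl refl
  falsificationᵂ only-b₂ _ = falsify b2 done refl refl refl refl refl

  split-stallᵂ : ∀ {b} → Normalᵂ b → split b ≡ true →
                 Σ WV λ r → legalᵂ b r ≡ true × residualᵂ b ≤ residualᵂ (playᵂ b r)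
  split-stallᵂ split-y _ = y , refl , ≤ᵇ-sound refl
  split-stallᵂ split-z _ = x , refl , ≤ᵇ-sound refl

  residualᵂ≡0⇒settled : ∀ {b} → Normalᵂ b → residualᵂ b ≡ 0 → undecided b ≡ false × split b ≡ false
  residualᵂ≡0⇒settled done _ = refl , refl

  settled⇒2∣residualᵂ : ∀ {b} → Normalᵂ b → undecided b ≡ false → split b ≡ false → 2 ∣ residualᵂ b
  settled⇒2∣residualᵂ half-x _ _ = divides 1 refl
  settled⇒2∣residualᵂ half-y _ _ = divides 1 refl
  settled⇒2∣residualᵂ done   _ _ = divides 0 refl

undecided⇒unsplit : ∀ {b} → Normalᵂ b → undecided b ≡ true → split b ≡ false
undecided⇒unsplit fresh   _ = refl
undecided⇒unsplit only-x  _ = refl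
undecided⇒unsplit only-x' _ = refl
undecided⇒unsplit only-y  _ = refl
undecided⇒unsplit only-y' _ = refl
undecided⇒unsplit only-z  _ = refl
undecided⇒unsplit only-b₁ _ = refl
undecided⇒unsplit only-b₂ _ = refl

data Normalᴾ : PathState → Set where
  untouched : Normalᴾ (path false false false false)
  finished  : Normalᴾ (path true  true  true  true )

dominatesClauses : PathMove → Bool
dominatesClauses clause      = true
dominatesClauses (vertex 0F) = true
dominatesClauses (vertex 1F) = false
dominatesClauses (vertex 2F) = false
dominatesClauses (vertex 3F) = true

data Answerᴾ (b : PathState) (m : PathMove) : Set where
  mirrors  : (r : Fin 4) → Normalᴾ (playᴾ (playᴾ b m) (vertex r)) → legalᴾ (playᴾ b m) (vertex r) ≡ true →
             dominatesClauses m ≡ false → dominatesClauses (vertex r) ≡ false →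
             residualᴾ b ≡ residualᴾ (playᴾ (playᴾ b m) (vertex r)) + 2 → Answerᴾ b m
  concedes : (r : Fin 4) → legalᴾ (playᴾ b m) (vertex r) ≡ true →
             residualᴾ b ≤ residualᴾ (playᴾ (playᴾ b m) (vertex r)) + 1 → Answerᴾ b m
  wastes   : residualᴾ b ≤ residualᴾ (playᴾ b m) → Answerᴾ b m

opaque
  unfolding legalᴾ finishedᴾ oneMoveFinishesᴾ residualᴾ

  residualᴾ-untouched : residualᴾ (path false false false false) ≡ 2
  residualᴾ-untouched = refl

  answerᴾ : ∀ {b} → Normalᴾ b → (m : PathMove) → Answerᴾ b m
  answerᴾ untouched clause      = concedes 0F refl (≤ᵇ-sound refl)
  answerᴾ untouched (vertex 0F) = concedes 1F refl (≤ᵇ-sound refl)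
  answerᴾ untouched (vertex 1F) = mirrors 2F finished refl refl refl refl
  answerᴾ untouched (vertex 2F) = mirrors 1F finished refl refl refl refl
  answerᴾ untouched (vertex 3F) = concedes 2F refl (≤ᵇ-sound refl)
  answerᴾ finished  _           = wastes (≤ᵇ-sound refl)

  2∣residualᴾ : ∀ {b} → Normalᴾ b → 2 ∣ residualᴾ b
  2∣residualᴾ untouched = divides 1 refl
  2∣residualᴾ finished  = divides 0 refl

module OnGF {k n : ℕ} (F : PosCNF k n) where

  open DomGame (GF F)

  Position : Set
  Position = V k n → Bool

  finEq-refl : ∀ {m} (i : Fin m) → finEq {k} {n} i i ≡ true
  finEq-refl i with i ≟ i
  ... | yes _  = refl
  ... | no i≢i with () ← i≢i refl

  finEq-≢ : ∀ {m} {i j : Fin m} → i ≢ j → finEq {k} {n} i j ≡ false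
  finEq-≢ {i = i} {j} i≢j with i ≟ j
  ... | yes i≡j with () ← i≢j i≡j
  ... | no _    = refl

  finEq-≡ : ∀ {m} {i j : Fin m} → finEq {k} {n} i j ≡ true → i ≡ j
  finEq-≡ {i = i} {j} e with i ≟ j
  ... | yes i≡j = i≡j

  eqWV-refl : ∀ s → eqWV s s ≡ true
  eqWV-refl a1 = refl
  eqWV-refl a2 = refl
  eqWV-refl x  = refl
  eqWV-refl x' = refl
  eqWV-refl y  = refl
  eqWV-refl y' = refl
  eqWV-refl z  = refl
  eqWV-refl b1 = refl
  eqWV-refl b2 = refl

  eqVk-refl : ∀ u → eqVk {k} {n} u u ≡ true
  eqVk-refl (w X s) rewrite finEq-refl X = eqWV-refl s
  eqVk-refl (c i)   = finEq-refl i
  eqVk-refl (p j)   = finEq-refl j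

  allV-complete : ∀ u → u ∈ allV {k} {n}
  allV-complete (w X s) = ∈-++⁺ˡ (∈-concat⁺′ (∈-map⁺ (w X) (allWV-complete s)) (∈-map⁺ _ (∈-allFin X)))
  allV-complete (c i)   = ∈-++⁺ʳ (concatMap _ (allFin k)) (∈-++⁺ˡ (∈-map⁺ c (∈-allFin i)))
  allV-complete (p j)   = ∈-++⁺ʳ (concatMap _ (allFin k)) (∈-++⁺ʳ (map c (allFin n)) (∈-map⁺ p (∈-allFin j)))

  N-same-widget : ∀ X t s → N[ w X t ] (w X s) ≡ N[ t ]ᵂ s
  N-same-widget X t s rewrite finEq-refl X = refl

  N-other-widget : ∀ {X Y} t s → Y ≢ X → N[ w X t ] (w Y s) ≡ false
  N-other-widget t s Y≢X rewrite finEq-≢ Y≢X | finEq-≢ (λ X≡Y → Y≢X (sym X≡Y)) = refl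

  N-widget-path : ∀ X t j → N[ w X t ] (p j) ≡ false
  N-widget-path X t 0F = refl
  N-widget-path X t 1F = refl
  N-widget-path X t 2F = refl
  N-widget-path X t 3F = refl

  N-path-path : ∀ i j → N[ p i ] (p j) ≡ N[ vertex i ]ᴾ j
  N-path-path 0F 0F = refl
  N-path-path 0F 1F = refl
  N-path-path 0F 2F = refl
  N-path-path 0F 3F = refl
  N-path-path 1F 0F = refl
  N-path-path 1F 1F = refl
  N-path-path 1F 2F = refl
  N-path-path 1F 3F = refl
  N-path-path 2F 0F = refl
  N-path-path 2F 1F = refl
  N-path-path 2F 2F = refl
  N-path-path 2F 3F = refl
  N-path-path 3F 0F = refl
  N-path-path 3F 1F = refl
  N-path-path 3F 2F = refl
  N-path-path 3F 3F = refl

  N-clause-widget : ∀ i Y s → inAᵂ s ≡ false → N[ c i ] (w Y s) ≡ false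
  N-clause-widget i Y x  _ = refl
  N-clause-widget i Y x' _ = refl
  N-clause-widget i Y y  _ = refl
  N-clause-widget i Y y' _ = refl
  N-clause-widget i Y z  _ = refl
  N-clause-widget i Y b1 _ = refl
  N-clause-widget i Y b2 _ = refl

  N-path-widget : ∀ j Y s → N[ p j ] (w Y s) ≡ false
  N-path-widget 0F Y s = refl
  N-path-widget 1F Y s = refl
  N-path-widget 2F Y s = refl
  N-path-widget 3F Y s = refl

  opaque
    widget : Position → Fin k → WidgetState
    widget dom X = state (dom (w X x)) (dom (w X x')) (dom (w X y)) (dom (w X y')) (dom (w X z))
                         (dom (w X b1)) (dom (w X b2))

    pathOf : Position → PathState
    pathOf dom = path (dom (p 0F)) (dom (p 1F)) (dom (p 2F)) (dom (p 3F))

    widget-play : ∀ dom X t → widget (addN dom (w X t)) X ≡ playᵂ (widget dom X) t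
    widget-play dom X t
      rewrite N-same-widget X t x | N-same-widget X t x' | N-same-widget X t y | N-same-widget X t y'
            | N-same-widget X t z | N-same-widget X t b1 | N-same-widget X t b2 = refl

    widget-cong : ∀ {dom dom′} Y → (∀ s → inAᵂ s ≡ false → dom′ (w Y s) ≡ dom (w Y s)) →
                  widget dom′ Y ≡ widget dom Y
    widget-cong Y e rewrite e x refl | e x' refl | e y refl | e y' refl | e z refl | e b1 refl | e b2 refl = refl

    pathOf-cong : ∀ {dom dom′} → (∀ j → dom′ (p j) ≡ dom (p j)) → pathOf dom′ ≡ pathOf dom
    pathOf-cong e rewrite e 0F | e 1F | e 2F | e 3F = refl

    pathOf-play : ∀ dom j → pathOf (addN dom (p j)) ≡ playᴾ (pathOf dom) (vertex j)
    pathOf-play dom 0F = refl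
    pathOf-play dom 1F = refl
    pathOf-play dom 2F = refl
    pathOf-play dom 3F = refl

    pathOf-play-clause : ∀ dom i → pathOf (addN dom (c i)) ≡ playᴾ (pathOf dom) clause
    pathOf-play-clause dom i = refl

  widget-play-other : ∀ dom {X Y} t → Y ≢ X → widget (addN dom (w X t)) Y ≡ widget dom Y
  widget-play-other dom {Y = Y} t Y≢X = widget-cong Y λ s _ → ∨-false (N-other-widget t s Y≢X)

  pathOf-play-widget : ∀ dom X t → pathOf (addN dom (w X t)) ≡ pathOf dom
  pathOf-play-widget dom X t = pathOf-cong λ j → ∨-false (N-widget-path X t j)

  data PathRegionMove : V k n → PathMove → Set where
    on-clause : ∀ i → PathRegionMove (c i) clause
    on-path   : ∀ j → PathRegionMove (p j) (vertex j)

  widget-play-path-region : ∀ {v m} → PathRegionMove v m → ∀ dom Y → widget (addN dom v) Y ≡ widget dom Y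
  widget-play-path-region (on-clause i) dom Y = widget-cong Y λ s s∉A → ∨-false (N-clause-widget i Y s s∉A)
  widget-play-path-region (on-path j)   dom Y = widget-cong Y λ s _ → ∨-false (N-path-widget j Y s)

  pathOf-play-path-region : ∀ {v m} → PathRegionMove v m → ∀ dom → pathOf (addN dom v) ≡ playᴾ (pathOf dom) m
  pathOf-play-path-region (on-clause i) dom = pathOf-play-clause dom i
  pathOf-play-path-region (on-path j)   dom = pathOf-play dom j

  widget-play² : ∀ dom X t r → widget (addN (addN dom (w X t)) (w X r)) X ≡ playᵂ (playᵂ (widget dom X) t) r
  widget-play² dom X t r = trans (widget-play (addN dom (w X t)) X r) (cong (λ b → playᵂ b r) (widget-play dom X t))

  widget-play²-other : ∀ dom {X Y} t r → Y ≢ X → widget (addN (addN dom (w X t)) (w X r)) Y ≡ widget dom Y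
  widget-play²-other dom {X} t r Y≢X = trans (widget-play-other (addN dom (w X t)) r Y≢X) (widget-play-other dom t Y≢X)

  widget-play²-path-region : ∀ {v m} → PathRegionMove v m → ∀ dom j Y →
                             widget (addN (addN dom v) (p j)) Y ≡ widget dom Y
  widget-play²-path-region {v} region dom j Y =
    trans (widget-play-path-region (on-path j) (addN dom v) Y) (widget-play-path-region region dom Y)

  widgets-after-move : ∀ {P : WidgetState → Set} dom X t → P (playᵂ (widget dom X) t) →
                       (∀ Z → Z ≢ X → P (widget dom Z)) → ∀ Z → P (widget (addN dom (w X t)) Z)
  widgets-after-move {P} dom X t PX P-others Z with Z ≟ X
  ... | yes refl = subst P (sym (widget-play dom X t)) PX
  ... | no Z≢X   = subst P (sym (widget-play-other dom t Z≢X)) (P-others Z Z≢X)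

  widgets-after-move² : ∀ {P : WidgetState → Set} dom X t r → P (playᵂ (playᵂ (widget dom X) t) r) →
                        (∀ Z → Z ≢ X → P (widget dom Z)) → ∀ Z → P (widget (addN (addN dom (w X t)) (w X r)) Z)
  widgets-after-move² {P} dom X t r PX P-others Z with Z ≟ X
  ... | yes refl = subst P (sym (widget-play² dom X t r)) PX
  ... | no Z≢X   = subst P (sym (widget-play²-other dom t r Z≢X)) (P-others Z Z≢X)

  opaque
    unfolding widget pathOf

    dominatedᵂ-widget : ∀ dom X {s} → s ∈ outsideA → dominatedᵂ (widget dom X) s ≡ dom (w X s)
    dominatedᵂ-widget dom X (here refl) = refl
    dominatedᵂ-widget dom X (there (here refl)) = refl
    dominatedᵂ-widget dom X (there (there (here refl))) = refl
    dominatedᵂ-widget dom X (there (there (there (here refl)))) = refl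
    dominatedᵂ-widget dom X (there (there (there (there (here refl))))) = refl
    dominatedᵂ-widget dom X (there (there (there (there (there (here refl)))))) = refl
    dominatedᵂ-widget dom X (there (there (there (there (there (there (here refl))))))) = refl

    widget-isA : ∀ X → widget isA X ≡ state false false false false false false false
    widget-isA X = refl

    pathOf-isA : pathOf isA ≡ path false false false false
    pathOf-isA = refl

    dominatedᴾ-pathOf : ∀ dom j → dominatedᴾ (pathOf dom) j ≡ dom (p j)
    dominatedᴾ-pathOf dom 0F = refl
    dominatedᴾ-pathOf dom 1F = refl
    dominatedᴾ-pathOf dom 2F = refl
    dominatedᴾ-pathOf dom 3F = refl

  legal-widget : ∀ dom X r → legalᵂ (widget dom X) r ≡ true → legal dom (w X r) ≡ true
  legal-widget dom X r lr with legalᵂ⁻ lr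
  ... | s , s∈ , h = any≡true⁺ _ (allV-complete (w X s))
                       (subst₂ (λ a d → a ∧ not d ≡ true) (sym (N-same-widget X r s)) (dominatedᵂ-widget dom X s∈) h)

  legal-path : ∀ dom j → legalᴾ (pathOf dom) (vertex j) ≡ true → legal dom (p j) ≡ true
  legal-path dom j lj with legalᴾ⁻ lj
  ... | i , h = any≡true⁺ _ (allV-complete (p i))
                  (subst₂ (λ a d → a ∧ not d ≡ true) (sym (N-path-path j i)) (dominatedᴾ-pathOf dom i) h)

  legal-widget-reply : ∀ dom X t r → legalᵂ (playᵂ (widget dom X) t) r ≡ true → legal (addN dom (w X t)) (w X r) ≡ true
  legal-widget-reply dom X t r lr =
    legal-widget (addN dom (w X t)) X r (subst (λ b → legalᵂ b r ≡ true) (sym (widget-play dom X t)) lr)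

  legal-path-reply : ∀ {v m} → PathRegionMove v m → ∀ dom j → legalᴾ (playᴾ (pathOf dom) m) (vertex j) ≡ true →
                     legal (addN dom v) (p j) ≡ true
  legal-path-reply region dom j lj =
    legal-path _ j (subst (λ b → legalᴾ b (vertex j) ≡ true) (sym (pathOf-play-path-region region dom)) lj)

  undominated-widget : ∀ dom X → 1 ≤ residualᵂ (widget dom X) → ∃ λ u → dom u ≡ false
  undominated-widget dom X 1≤ρ with finishedᵂ (widget dom X) in fin
  ... | true with () ← subst (1 ≤_) (residualᵂ-finished fin) 1≤ρ
  ... | false with finishedᵂ⁻ fin
  ...   | s , s∈ , h = w X s , trans (sym (dominatedᵂ-widget dom X s∈)) h

  undominated-path : ∀ dom → 1 ≤ residualᴾ (pathOf dom) → ∃ λ u → dom u ≡ false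
  undominated-path dom 1≤ρ with finishedᴾ (pathOf dom) in fin
  ... | true with () ← subst (1 ≤_) (residualᴾ-finished fin) 1≤ρ
  ... | false with finishedᴾ⁻ fin
  ...   | j , h = p j , trans (sym (dominatedᴾ-pathOf dom j)) h

  isA-w≡inAᵂ : ∀ t → isA-w {k} {n} t ≡ inAᵂ t
  isA-w≡inAᵂ a1 = refl
  isA-w≡inAᵂ a2 = refl
  isA-w≡inAᵂ x  = refl
  isA-w≡inAᵂ x' = refl
  isA-w≡inAᵂ y  = refl
  isA-w≡inAᵂ y' = refl
  isA-w≡inAᵂ z  = refl
  isA-w≡inAᵂ b1 = refl
  isA-w≡inAᵂ b2 = refl

  inClause⇒∈ : ∀ i X → inClause F i X ≡ true → X ∈ F i
  inClause⇒∈ i X e with any≡true⁻ _ (F i) e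
  ... | Y , Y∈ , X≡Y = subst (_∈ F i) (sym (finEq-≡ X≡Y)) Y∈

  clause-after-widget : ∀ dom X t i → addN dom (w X t) (c i) ≡ true → dom (c i) ≡ true ⊎ X ∈ F i
  clause-after-widget dom X t i e with dom (c i)
  ... | true  = inj₁ refl
  ... | false = inj₂ (inClause⇒∈ i X (proj₂ (∧-sound e)))

  clause-after-widget-outside-A : ∀ dom X t i → inAᵂ t ≡ false → addN dom (w X t) (c i) ≡ dom (c i)
  clause-after-widget-outside-A dom X t i t∉A rewrite isA-w≡inAᵂ t | t∉A = ∨-identityʳ _

  clause-after-path-region : ∀ {v m} → PathRegionMove v m → dominatesClauses m ≡ false →
                             ∀ dom i → addN dom v (c i) ≡ dom (c i)
  clause-after-path-region (on-clause _) ()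
  clause-after-path-region (on-path 0F) ()
  clause-after-path-region (on-path 1F) _ dom i = ∨-identityʳ _
  clause-after-path-region (on-path 2F) _ dom i = ∨-identityʳ _
  clause-after-path-region (on-path 3F) ()

  potential : Position → ℕ
  potential dom = sum (λ X → residualᵂ (widget dom X)) + residualᴾ (pathOf dom)

  potential-widget : ∀ dom X t → potential (addN dom (w X t)) + residualᵂ (widget dom X) ≡
                                 potential dom + residualᵂ (playᵂ (widget dom X) t)
  potential-widget dom X t rewrite pathOf-play-widget dom X t | sym (widget-play dom X t) =
    balance-+ {a = sum ρ} {a′ = sum ρ′} (residualᴾ (pathOf dom))
      (sum-update ρ ρ′ X (λ Y Y≢X → cong residualᵂ (widget-play-other dom t Y≢X)))
    where
      ρ ρ′ : Fin k → ℕ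
      ρ  Y = residualᵂ (widget dom Y)
      ρ′ Y = residualᵂ (widget (addN dom (w X t)) Y)

  potential-path-region : ∀ {v m} → PathRegionMove v m → ∀ dom →
    potential (addN dom v) + residualᴾ (pathOf dom) ≡ potential dom + residualᴾ (playᴾ (pathOf dom) m)
  potential-path-region {v} {m} mv dom
    rewrite sum-cong-≗ (λ Y → cong residualᵂ (widget-play-path-region mv dom Y))
          | pathOf-play-path-region mv dom =
    +-swapʳ (sum (λ Y → residualᵂ (widget dom Y))) (residualᴾ (playᴾ (pathOf dom) m)) (residualᴾ (pathOf dom))

  potential-widget² : ∀ dom X t r →
    potential (addN (addN dom (w X t)) (w X r)) + residualᵂ (widget dom X) ≡
    potential dom + residualᵂ (playᵂ (playᵂ (widget dom X) t) r)
  potential-widget² dom X t r =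
    balance-trans {a′ = potential (addN dom (w X t))} (potential-widget dom X t)
      (subst (λ b → potential (addN (addN dom (w X t)) (w X r)) + residualᵂ b ≡
                    potential (addN dom (w X t)) + residualᵂ (playᵂ b r))
             (widget-play dom X t) (potential-widget (addN dom (w X t)) X r))

  potential-path-region² : ∀ {v m} → PathRegionMove v m → ∀ dom j →
    potential (addN (addN dom v) (p j)) + residualᴾ (pathOf dom) ≡
    potential dom + residualᴾ (playᴾ (playᴾ (pathOf dom) m) (vertex j))
  potential-path-region² {v} {m} mv dom j =
    balance-trans {a′ = potential (addN dom v)} (potential-path-region mv dom)
      (subst (λ b → potential (addN (addN dom v) (p j)) + residualᴾ b ≡
                    potential (addN dom v) + residualᴾ (playᴾ b (vertex j)))
             (pathOf-play-path-region mv dom) (potential-path-region (on-path j) (addN dom v)))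

  potential≡widgets : ∀ dom → finishedᴾ (pathOf dom) ≡ true → potential dom ≡ sum (λ X → residualᵂ (widget dom X))
  potential≡widgets dom fin rewrite residualᴾ-finished fin = +-identityʳ _

  Reply : (ℕ → Position → Set) → ℕ → Position → V k n → Set
  Reply Secures m dom v = ∃ λ u → legal (addN dom v) u ≡ true × Secures m (addN (addN dom v) u)

  staller-move : ∀ {m} dom → suc m ≤ potential dom → ∃ λ u → legal dom u ≡ true × m ≤ potential (addN dom u)
  staller-move {m} dom m<Φ with finishedᴾ (pathOf dom) in fin
  ... | false = let j , lj , bound = residualᴾ-move (pathOf dom) fin in
                p j , legal-path dom j lj , +-≤-cancel 1 m<Φ (balance-≤ (potential-path-region (on-path j) dom) bound)
  ... | true with 0<sum⇒∃0< (λ X → residualᵂ (widget dom X))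
                   (≤-trans (s≤s z≤n) (subst (suc m ≤_) (potential≡widgets dom fin) m<Φ))
  ...   | X , 0<ρ with finishedᵂ (widget dom X) in finX
  ...     | true with () ← subst (1 ≤_) (residualᵂ-finished finX) 0<ρ
  ...     | false = let r , lr , bound = residualᵂ-move (widget dom X) finX in
                    w X r , legal-widget dom X r lr , +-≤-cancel 1 m<Φ (balance-≤ (potential-widget dom X r) bound)

  Slack : ℕ → Position → Set
  Slack m dom = m ≤ potential dom

  staller-reply-path-region : ∀ {m v mv} → PathRegionMove v mv → ∀ dom →
                              suc (suc m) ≤ potential dom → Reply Slack m dom v
  staller-reply-path-region {m} {v} {mv} region dom m+2≤Φ with residualᴾ-reply (pathOf dom) mv
  ... | inj₁ (fin , ρ≤1) =
    staller-move (addN dom v) (+-≤-cancel 1 m+2≤Φ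
      (balance-≤ (potential-path-region region dom) (subst (residualᴾ (pathOf dom) ≤_)
                 (cong (_+ 1) (sym (residualᴾ-finished fin))) ρ≤1)))
  ... | inj₂ (j , lj , bound) =
    p j , legal-path-reply region dom j lj ,
    +-≤-cancel 2 m+2≤Φ (balance-≤ (potential-path-region² region dom j) bound)

  staller-reply-slack : ∀ {m} dom v → suc (suc m) ≤ potential dom → Reply Slack m dom v
  staller-reply-slack {m} dom (w X t) m+2≤Φ with residualᵂ-reply (widget dom X) t
  ... | inj₁ (fin , ρ≤1) =
    staller-move (addN dom (w X t)) (+-≤-cancel 1 m+2≤Φ
      (balance-≤ (potential-widget dom X t) (subst (residualᵂ (widget dom X) ≤_)
                 (cong (_+ 1) (sym (residualᵂ-finished fin))) ρ≤1)))
  ... | inj₂ (r , lr , bound) =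
    w X r , legal-widget-reply dom X t r lr ,
    +-≤-cancel 2 m+2≤Φ (balance-≤ (potential-widget² dom X t r) bound)
  staller-reply-slack dom (c i) = staller-reply-path-region (on-clause i) dom
  staller-reply-slack dom (p j) = staller-reply-path-region (on-path j) dom

module _ {k : ℕ} (σ : PAssign k) (X : Fin k) (b : Bool) where

  setVar-same : setVar σ X b X ≡ just b
  setVar-same with X ≟ X
  ... | yes _ = refl
  ... | no X≢X with () ← X≢X refl

  setVar-other : ∀ {Y} → Y ≢ X → setVar σ X b Y ≡ σ Y
  setVar-other {Y} Y≢X with Y ≟ X
  ... | yes Y≡X with () ← Y≢X Y≡X
  ... | no _    = refl

module Tightness {k n : ℕ} (F : PosCNF k n) where

  open DomGame (GF F)
  open OnGF F

  record Consistent (σ : PAssign k) (dom : Position) : Set where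
    field
      unset⇒undecided  : ∀ X → σ X ≡ nothing → undecided (widget dom X) ≡ true
      undecided⇒unset  : ∀ X → undecided (widget dom X) ≡ true → σ X ≡ nothing
      split⇒true       : ∀ X → split (widget dom X) ≡ true → σ X ≡ just true
      clause-satisfied : ∀ i → dom (c i) ≡ true → ∃ λ X → X ∈ F i × σ X ≡ just true

  open Consistent

  module _ {σ dom dom′ X} (con : Consistent σ dom)
           (same : ∀ Z → Z ≢ X → widget dom′ Z ≡ widget dom Z)
           (decided : undecided (widget dom′ X) ≡ false) where

    consistent-setVar : ∀ {b} → σ X ≡ nothing → (split (widget dom′ X) ≡ true → b ≡ true) →
                        (∀ i → dom′ (c i) ≡ true → dom (c i) ≡ true ⊎ (b ≡ true × X ∈ F i)) →
                        Consistent (setVar σ X b) dom′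
    consistent-setVar {b} unset split⇒b new-clause = record
      { unset⇒undecided = unset′ ; undecided⇒unset = undecided′ ; split⇒true = split′ ; clause-satisfied = clause′ }
      where
        σ′ = setVar σ X b

        unset′ : ∀ Z → σ′ Z ≡ nothing → undecided (widget dom′ Z) ≡ true
        unset′ Z σ′Z with Z ≟ X | σ′Z
        ... | yes refl | ()
        ... | no Z≢X   | σZ = trans (cong undecided (same Z Z≢X)) (unset⇒undecided con Z σZ)

        undecided′ : ∀ Z → undecided (widget dom′ Z) ≡ true → σ′ Z ≡ nothing
        undecided′ Z und with Z ≟ X
        ... | yes refl with () ← trans (sym decided) und
        ... | no Z≢X = undecided⇒unset con Z (trans (cong undecided (sym (same Z Z≢X))) und)

        split′ : ∀ Z → split (widget dom′ Z) ≡ true → σ′ Z ≡ just true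
        split′ Z spl with Z ≟ X
        ... | yes refl = cong just (split⇒b spl)
        ... | no Z≢X = split⇒true con Z (trans (cong split (sym (same Z Z≢X))) spl)

        clause′ : ∀ i → dom′ (c i) ≡ true → ∃ λ Z → Z ∈ F i × σ′ Z ≡ just true
        clause′ i dom′cᵢ with new-clause i dom′cᵢ
        ... | inj₂ (refl , X∈Fᵢ) = X , X∈Fᵢ , setVar-same σ X true
        ... | inj₁ domcᵢ with clause-satisfied con i domcᵢ
        ...   | Z , Z∈Fᵢ , σZ = Z , Z∈Fᵢ , trans (setVar-other σ X b Z≢X) σZ
          where Z≢X : Z ≢ X
                Z≢X refl with () ← trans (sym unset) σZ

    consistent-keep : σ X ≡ just true → (∀ i → dom′ (c i) ≡ true → dom (c i) ≡ true ⊎ X ∈ F i) →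
                      Consistent σ dom′
    consistent-keep σX new-clause = record
      { unset⇒undecided = unset′ ; undecided⇒unset = undecided′ ; split⇒true = split′ ; clause-satisfied = clause′ }
      where
        unset′ : ∀ Z → σ Z ≡ nothing → undecided (widget dom′ Z) ≡ true
        unset′ Z σZ with Z ≟ X
        ... | yes refl with () ← trans (sym σX) σZ
        ... | no Z≢X = trans (cong undecided (same Z Z≢X)) (unset⇒undecided con Z σZ)

        undecided′ : ∀ Z → undecided (widget dom′ Z) ≡ true → σ Z ≡ nothing
        undecided′ Z und with Z ≟ X
        ... | yes refl with () ← trans (sym decided) und
        ... | no Z≢X = undecided⇒unset con Z (trans (cong undecided (sym (same Z Z≢X))) und)

        split′ : ∀ Z → split (widget dom′ Z) ≡ true → σ Z ≡ just true
        split′ Z spl with Z ≟ X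
        ... | yes refl = σX
        ... | no Z≢X = split⇒true con Z (trans (cong split (sym (same Z Z≢X))) spl)

        clause′ : ∀ i → dom′ (c i) ≡ true → ∃ λ Z → Z ∈ F i × σ Z ≡ just true
        clause′ i dom′cᵢ with new-clause i dom′cᵢ
        ... | inj₁ domcᵢ = clause-satisfied con i domcᵢ
        ... | inj₂ X∈Fᵢ  = X , X∈Fᵢ , σX

  record SameStatus (dom dom′ : Position) : Set where
    field
      undecided-same : ∀ Z → undecided (widget dom′ Z) ≡ undecided (widget dom Z)
      split-same     : ∀ Z → split (widget dom′ Z) ≡ split (widget dom Z)
      clauses-same   : ∀ i → dom′ (c i) ≡ dom (c i)
  open SameStatus

  consistent-transfer : ∀ {σ dom dom′} → SameStatus dom dom′ → Consistent σ dom → Consistent σ dom′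
  consistent-transfer same con = record
    { unset⇒undecided  = λ Z σZ → trans (undecided-same same Z) (unset⇒undecided con Z σZ)
    ; undecided⇒unset  = λ Z und → undecided⇒unset con Z (trans (sym (undecided-same same Z)) und)
    ; split⇒true       = λ Z spl → split⇒true con Z (trans (sym (split-same same Z)) spl)
    ; clause-satisfied = λ i dc → clause-satisfied con i (trans (sym (clauses-same same i)) dc)
    }

  Unsplit : Position → Fin k → Set
  Unsplit dom X = split (widget dom X) ≡ false

  NoSplit : Position → Set
  NoSplit dom = ∀ X → Unsplit dom X

  OneSplit : Position → Set
  OneSplit dom = ∃ λ Y → split (widget dom Y) ≡ true × ∀ X → X ≢ Y → Unsplit dom X

  TwoSplits : Position → Set
  TwoSplits dom = ∃₂ λ Y₁ Y₂ → Y₁ ≢ Y₂ × split (widget dom Y₁) ≡ true × split (widget dom Y₂) ≡ true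

  -- The POS-CNF position that the domination game position mirrors; once two
  -- widgets are split Staller has a spare move and the formula is forgotten.
  data Phase (dom : Position) : Set where
    two-splits      : TwoSplits dom → Phase dom
    player1-to-move : ∀ σ → Consistent σ dom → NoSplit dom → P2Wins F σ P1 → Phase dom
    player2-to-move : ∀ σ → Consistent σ dom → OneSplit dom → P2Wins F σ P2 → Phase dom

  phase-transfer : ∀ {dom dom′} → SameStatus dom dom′ → Phase dom → Phase dom′
  phase-transfer same (two-splits (Y₁ , Y₂ , Y₁≢Y₂ , s₁ , s₂)) =
    two-splits (Y₁ , Y₂ , Y₁≢Y₂ , trans (split-same same Y₁) s₁ , trans (split-same same Y₂) s₂)
  phase-transfer same (player1-to-move σ con none win) =
    player1-to-move σ (consistent-transfer same con) (λ Z → trans (split-same same Z) (none Z)) win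
  phase-transfer same (player2-to-move σ con (Y , sY , others) win) =
    player2-to-move σ (consistent-transfer same con)
      (Y , trans (split-same same Y) sY , λ Z Z≢Y → trans (split-same same Z) (others Z Z≢Y)) win

  Normal-widgets : Position → Set
  Normal-widgets dom = ∀ X → Normalᵂ (widget dom X)

  record Tight (dom : Position) : Set where
    field
      normalᵂ : Normal-widgets dom
      normalᴾ : Normalᴾ (pathOf dom)
      even    : 2 ∣ potential dom
      phase   : Phase dom

  -- Either the potential already covers m more moves, or it falls one short and
  -- the position is tight; that last move is paid for by an unsatisfied clause.
  Secures : ℕ → Position → Set
  Secures m dom = m ≤ potential dom ⊎ (m ≡ suc (potential dom) × Tight dom)

  -- Settled widgets and normal paths have even residuals.
  potential-even : ∀ {σ dom} → Normal-widgets dom → Normalᴾ (pathOf dom) → Consistent σ dom →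
                   AllSet σ → NoSplit dom → 2 ∣ potential dom
  potential-even {σ} {dom} normal normalᴾ con all-set none =
    ∣m∣n⇒∣m+n (∣-sum _ even-widget) (2∣residualᴾ normalᴾ)
    where
      even-widget : ∀ X → 2 ∣ residualᵂ (widget dom X)
      even-widget X with undecided (widget dom X) in und
      ... | true  with () ← all-set X (undecided⇒unset con X und)
      ... | false = settled⇒2∣residualᵂ (normal X) und (none X)

  -- Staller's answer as Player 2 (setting some variable FALSE), restoring
  -- tightness after Dominator's move left an odd potential.
  player2-answer : ∀ {σ dom} → Normal-widgets dom → Normalᴾ (pathOf dom) → Consistent σ dom → NoSplit dom →
                   P2Wins F σ P2 → 2 ∣ suc (potential dom) →
                   ∃ λ u → legal dom u ≡ true × Secures (potential dom) (addN dom u)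
  player2-answer normal normalᴾ con none (finished all-set _) 2∣1+Φ =
    ⊥-elim (2∣⇒2∤suc (potential-even normal normalᴾ con all-set none) 2∣1+Φ)
  player2-answer {σ} {dom} normal normalᴾ con none (p2-move Y σY win) 2∣1+Φ
    with falsificationᵂ (normal Y) (unset⇒undecided con Y σY)
  ... | falsify r normalY legal decided unsplit drop outside-A =
    w Y r , legal-widget dom Y r legal , inj₂ (Φ≡1+Φ′ , record
      { normalᵂ = widgets-after-move {Normalᵂ} dom Y r normalY (λ Z _ → normal Z)
      ; normalᴾ = subst Normalᴾ (sym (pathOf-play-widget dom Y r)) normalᴾ
      ; even    = 2∣2+⇒2∣ (subst (λ a → 2 ∣ suc a) Φ≡1+Φ′ 2∣1+Φ)
      ; phase   = player1-to-move (setVar σ Y false)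
                    (consistent-setVar con (λ Z Z≢Y → widget-play-other dom r Z≢Y)
                       (trans (cong undecided (widget-play dom Y r)) decided) σY
                       (λ s → trans (sym (trans (cong split (widget-play dom Y r)) unsplit)) s)
                       (λ i dc → inj₁ (trans (sym (clause-after-widget-outside-A dom Y r i outside-A)) dc)))
                    (widgets-after-move {λ b → split b ≡ false} dom Y r unsplit (λ Z _ → none Z)) win
      })
    where
      Φ≡1+Φ′ : potential dom ≡ suc (potential (addN dom (w Y r)))
      Φ≡1+Φ′ = balance-suc (potential-widget dom Y r) drop

  split-stall : ∀ {m dom Y} → Normalᵂ (widget dom Y) → split (widget dom Y) ≡ true → m ≤ potential dom →
                ∃ λ u → legal dom u ≡ true × Secures m (addN dom u)
  split-stall {m} {dom} {Y} normal spl m≤Φ with split-stallᵂ normal spl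
  ... | r , lr , ρ≤ρ′ = w Y r , legal-widget dom Y r lr ,
        inj₁ (≤-trans m≤Φ (balance-≤′ (potential-widget dom Y r) ρ≤ρ′))

  undecided⇒≢split : ∀ {dom X Y} → Normal-widgets dom → undecided (widget dom X) ≡ true →
                     split (widget dom Y) ≡ true → Y ≢ X
  undecided⇒≢split normal und spl refl with () ← trans (sym (undecided⇒unsplit (normal _) und)) spl

  module _ {m dom} (Φ≡1+m : potential dom ≡ suc m) (tight : Tight dom) where
    open Tight tight renaming (normalᵂ to normal)

    private
      stall-elsewhere : ∀ {X t Y} → split (widget dom Y) ≡ true → Y ≢ X →
                        potential dom ≡ suc (potential (addN dom (w X t))) → Reply Secures m dom (w X t)
      stall-elsewhere {X} {t} {Y} spl Y≢X Φ≡1+Φ′ =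
        split-stall (subst Normalᵂ (sym same) (normal Y)) (trans (cong split same) spl)
                    (≤-reflexive (suc-injective (trans (sym Φ≡1+m) Φ≡1+Φ′)))
        where same = widget-play-other dom t Y≢X

      answer-as-player2 : ∀ {X t σ} → Normalᵂ (playᵂ (widget dom X) t) → Consistent σ (addN dom (w X t)) →
                          NoSplit (addN dom (w X t)) → P2Wins F σ P2 →
                          potential dom ≡ suc (potential (addN dom (w X t))) → Reply Secures m dom (w X t)
      answer-as-player2 {X} {t} normalX con none win Φ≡1+Φ′
        with player2-answer (widgets-after-move {Normalᵂ} dom X t normalX (λ Z _ → normal Z))
                            (subst Normalᴾ (sym (pathOf-play-widget dom X t)) normalᴾ) con none win
                            (subst (2 ∣_) Φ≡1+Φ′ even)
      ... | u , lu , secures = u , lu , subst (λ a → Secures a _) (suc-injective (trans (sym Φ≡1+Φ′) Φ≡1+m)) secures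

    -- Dominator completed an undecided widget: read as Player 1 setting X TRUE.
    answer-finished-undecided : ∀ {X t} → Normalᵂ (playᵂ (widget dom X) t) → undecided (widget dom X) ≡ true →
      undecided (playᵂ (widget dom X) t) ≡ false → split (playᵂ (widget dom X) t) ≡ false →
      potential dom ≡ suc (potential (addN dom (w X t))) → Reply Secures m dom (w X t)
    answer-finished-undecided {X} {t} normalX und decided unsplit Φ≡1+Φ′ with phase
    ... | two-splits (Y , _ , _ , sY , _) = stall-elsewhere sY (undecided⇒≢split normal und sY) Φ≡1+Φ′
    ... | player2-to-move _ _ (Y , sY , _) _ = stall-elsewhere sY (undecided⇒≢split normal und sY) Φ≡1+Φ′
    ... | player1-to-move σ con none (finished all-set _) with () ← all-set X (undecided⇒unset con X und)
    ... | player1-to-move σ con none (p1-move _ win) =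
      answer-as-player2 normalX
        (consistent-setVar con (λ Z Z≢X → widget-play-other dom t Z≢X)
           (trans (cong undecided (widget-play dom X t)) decided) (undecided⇒unset con X und) (λ _ → refl)
           (λ i dc → map₂ (refl ,_) (clause-after-widget dom X t i dc)))
        (widgets-after-move {λ b → split b ≡ false} dom X t unsplit (λ Z _ → none Z))
        (win X (undecided⇒unset con X und)) Φ≡1+Φ′

    answer-finished-split : ∀ {X t} → Normalᵂ (playᵂ (widget dom X) t) → split (widget dom X) ≡ true →
      undecided (playᵂ (widget dom X) t) ≡ false → split (playᵂ (widget dom X) t) ≡ false →
      potential dom ≡ suc (potential (addN dom (w X t))) → Reply Secures m dom (w X t)
    answer-finished-split {X} {t} normalX spl decided unsplit Φ≡1+Φ′ with phase
    ... | two-splits (Y₁ , Y₂ , Y₁≢Y₂ , s₁ , s₂) with Y₁ ≟ X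
    ...   | yes refl = stall-elsewhere s₂ (λ Y₂≡X → Y₁≢Y₂ (sym Y₂≡X)) Φ≡1+Φ′
    ...   | no Y₁≢X  = stall-elsewhere s₁ Y₁≢X Φ≡1+Φ′
    answer-finished-split {X} _ spl _ _ _ | player1-to-move _ _ none _ with () ← trans (sym (none X)) spl
    answer-finished-split {X} {t} normalX spl decided unsplit Φ≡1+Φ′ | player2-to-move σ con (Y , _ , others) win
      with X ≟ Y
    ... | no X≢Y with () ← trans (sym (others X X≢Y)) spl
    ... | yes refl =
      answer-as-player2 normalX
        (consistent-keep con (λ Z Z≢X → widget-play-other dom t Z≢X)
           (trans (cong undecided (widget-play dom X t)) decided) (split⇒true con X spl)
           (λ i dc → clause-after-widget dom X t i dc))
        (widgets-after-move {λ b → split b ≡ false} dom X t unsplit others) win Φ≡1+Φ′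

    -- Dominator played a₁ or a₂ in the fresh widget X and Staller split it:
    -- read as Player 1 setting X TRUE.
    phase-after-truth : ∀ {X t r} → undecided (widget dom X) ≡ true →
      split (playᵂ (playᵂ (widget dom X) t) r) ≡ true → undecided (playᵂ (playᵂ (widget dom X) t) r) ≡ false →
      inAᵂ r ≡ false → Phase (addN (addN dom (w X t)) (w X r))
    phase-after-truth {X} {t} {r} und spl decided r∉A with phase
    ... | two-splits (Y₁ , Y₂ , Y₁≢Y₂ , s₁ , s₂) = two-splits (Y₁ , Y₂ , Y₁≢Y₂ , kept s₁ , kept s₂)
      where
        kept : ∀ {Y} → split (widget dom Y) ≡ true → split (widget (addN (addN dom (w X t)) (w X r)) Y) ≡ true
        kept sY = trans (cong split (widget-play²-other dom t r (undecided⇒≢split normal und sY))) sY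
    ... | player2-to-move _ _ (Y , sY , _) _ =
      two-splits (X , Y , (λ X≡Y → undecided⇒≢split normal und sY (sym X≡Y)) ,
                  trans (cong split (widget-play² dom X t r)) spl ,
                  trans (cong split (widget-play²-other dom t r (undecided⇒≢split normal und sY))) sY)
    ... | player1-to-move σ con none (finished all-set _) with () ← all-set X (undecided⇒unset con X und)
    ... | player1-to-move σ con none (p1-move _ win) =
      player2-to-move (setVar σ X true)
        (consistent-setVar con (λ Z Z≢X → widget-play²-other dom t r Z≢X)
           (trans (cong undecided (widget-play² dom X t r)) decided) (undecided⇒unset con X und) (λ _ → refl)
           (λ i dc → map₂ (refl ,_)
              (clause-after-widget dom X t i (trans (sym (clause-after-widget-outside-A (addN dom (w X t)) X r i r∉A)) dc))))
        (X , trans (cong split (widget-play² dom X t r)) spl , λ Z Z≢X → trans (cong split (widget-play²-other dom t r Z≢X)) (none Z))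
        (win X (undecided⇒unset con X und))

    tight-after-widget-pair : ∀ {X t r} → Normalᵂ (playᵂ (playᵂ (widget dom X) t) r) →
      residualᵂ (widget dom X) ≡ residualᵂ (playᵂ (playᵂ (widget dom X) t) r) + 2 →
      Phase (addN (addN dom (w X t)) (w X r)) → Secures m (addN (addN dom (w X t)) (w X r))
    tight-after-widget-pair {X} {t} {r} normalX drop phase′ = inj₂ (suc-injective (trans (sym Φ≡1+m) Φ≡2+Φ′) , record
      { normalᵂ = widgets-after-move² {Normalᵂ} dom X t r normalX (λ Z _ → normal Z)
      ; normalᴾ = subst Normalᴾ (sym (trans (pathOf-play-widget (addN dom (w X t)) X r) (pathOf-play-widget dom X t))) normalᴾ
      ; even    = 2∣2+⇒2∣ (subst (2 ∣_) Φ≡2+Φ′ even)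
      ; phase   = phase′
      })
      where
        Φ≡2+Φ′ : potential dom ≡ 2 + potential (addN (addN dom (w X t)) (w X r))
        Φ≡2+Φ′ = trans (balance-≡ (potential-widget² dom X t r) drop) (+-comm _ 2)

    tight-after-path-pair : ∀ {v mv j} → PathRegionMove v mv → Normalᴾ (playᴾ (playᴾ (pathOf dom) mv) (vertex j)) →
      residualᴾ (pathOf dom) ≡ residualᴾ (playᴾ (playᴾ (pathOf dom) mv) (vertex j)) + 2 →
      SameStatus dom (addN (addN dom v) (p j)) → Secures m (addN (addN dom v) (p j))
    tight-after-path-pair {v} {mv} {j} region normalP drop same = inj₂ (suc-injective (trans (sym Φ≡1+m) Φ≡2+Φ′) , record
      { normalᵂ = λ Z → subst Normalᵂ (sym (widget-play²-path-region region dom j Z)) (normal Z)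
      ; normalᴾ = subst Normalᴾ (sym (trans (pathOf-play-path-region (on-path j) (addN dom v))
                                            (cong (λ b → playᴾ b (vertex j)) (pathOf-play-path-region region dom)))) normalP
      ; even    = 2∣2+⇒2∣ (subst (2 ∣_) Φ≡2+Φ′ even)
      ; phase   = phase-transfer same phase
      })
      where
        Φ≡2+Φ′ : potential dom ≡ 2 + potential (addN (addN dom v) (p j))
        Φ≡2+Φ′ = trans (balance-≡ (potential-path-region² region dom j) drop) (+-comm _ 2)

    private
      after-wasted-move : ∀ {v} → potential dom ≤ potential (addN dom v) → Reply Secures m dom v
      after-wasted-move {v} Φ≤Φ′ with staller-move (addN dom v) (subst (_≤ potential (addN dom v)) Φ≡1+m Φ≤Φ′)
      ... | u , lu , m≤Φ″ = u , lu , inj₁ m≤Φ″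

    tight-reply-widget : ∀ X t → Reply Secures m dom (w X t)
    tight-reply-widget X t with answerᵂ (normal X) t
    ... | wastes ρ≤ρ′ = after-wasted-move (balance-≤′ (potential-widget dom X t) ρ≤ρ′)
    ... | concedes r lr ρ≤ρ″+1 = w X r , legal-widget-reply dom X t r lr ,
          inj₁ (+-≤-cancel 1 (≤-reflexive (sym Φ≡1+m)) (balance-≤ (potential-widget² dom X t r) ρ≤ρ″+1))
    ... | mirrors r normalX lr und≡ split≡ t∉A r∉A drop = w X r , legal-widget-reply dom X t r lr ,
          tight-after-widget-pair normalX drop (phase-transfer same phase)
      where
        same : SameStatus dom (addN (addN dom (w X t)) (w X r))
        same = record
          { undecided-same = λ Z → status undecided und≡ Z
          ; split-same     = λ Z → status split split≡ Z
          ; clauses-same   = λ i → trans (clause-after-widget-outside-A (addN dom (w X t)) X r i r∉A)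
                                         (clause-after-widget-outside-A dom X t i t∉A)
          }
          where
            status : (f : WidgetState → Bool) → f (playᵂ (playᵂ (widget dom X) t) r) ≡ f (widget dom X) →
                     ∀ Z → f (widget (addN (addN dom (w X t)) (w X r)) Z) ≡ f (widget dom Z)
            status f fX≡ Z with Z ≟ X
            ... | yes refl = trans (cong f (widget-play² dom X t r)) fX≡
            ... | no Z≢X   = cong f (widget-play²-other dom t r Z≢X)
    ... | sets-true r normalX lr spl decided und drop r∉A = w X r , legal-widget-reply dom X t r lr ,
          tight-after-widget-pair normalX drop (phase-after-truth und spl decided r∉A)
    ... | finishes-undecided normalX und decided unsplit drop =
          answer-finished-undecided normalX und decided unsplit (balance-suc (potential-widget dom X t) drop)
    ... | finishes-split normalX spl decided unsplit drop =
          answer-finished-split normalX spl decided unsplit (balance-suc (potential-widget dom X t) drop)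

    tight-reply-path-region : ∀ {v mv} → PathRegionMove v mv → Reply Secures m dom v
    tight-reply-path-region {v} {mv} region with answerᴾ normalᴾ mv
    ... | wastes ρ≤ρ′ = after-wasted-move (balance-≤′ (potential-path-region region dom) ρ≤ρ′)
    ... | concedes j lj ρ≤ρ″+1 = p j , legal-path-reply region dom j lj ,
          inj₁ (+-≤-cancel 1 (≤-reflexive (sym Φ≡1+m)) (balance-≤ (potential-path-region² region dom j) ρ≤ρ″+1))
    ... | mirrors j normalP lj mv∉Q j∉Q drop = p j , legal-path-reply region dom j lj ,
          tight-after-path-pair region normalP drop record
            { undecided-same = λ Z → cong undecided (widget-play²-path-region region dom j Z)
            ; split-same     = λ Z → cong split (widget-play²-path-region region dom j Z)
            ; clauses-same   = λ i → trans (clause-after-path-region (on-path j) j∉Q (addN dom v) i)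
                                           (clause-after-path-region region mv∉Q dom i)
            }

  staller-reply : ∀ {m dom v} → Secures (suc (suc m)) dom → legal dom v ≡ true → Reply Secures m dom v
  staller-reply {v = v} (inj₁ m+2≤Φ) _ with staller-reply-slack _ v m+2≤Φ
  ... | u , lu , m≤Φ′ = u , lu , inj₁ m≤Φ′
  staller-reply {v = w X t} (inj₂ (e , tight)) _ = tight-reply-widget (sym (suc-injective e)) tight X t
  staller-reply {v = c i}   (inj₂ (e , tight)) _ = tight-reply-path-region (sym (suc-injective e)) tight (on-clause i)
  staller-reply {v = p j}   (inj₂ (e , tight)) _ = tight-reply-path-region (sym (suc-injective e)) tight (on-path j)

  undominated-if-potential : ∀ dom → 1 ≤ potential dom → ∃ λ u → dom u ≡ false
  undominated-if-potential dom 0<Φ with finishedᴾ (pathOf dom) in fin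
  ... | false = undominated-path dom (residualᴾ-unfinished fin)
  ... | true with 0<sum⇒∃0< (λ X → residualᵂ (widget dom X)) (subst (1 ≤_) (potential≡widgets dom fin) 0<Φ)
  ...   | X , 0<ρ = undominated-widget dom X 0<ρ

  settled-if-potential-zero : ∀ {dom} → Normal-widgets dom → potential dom ≡ 0 →
                              ∀ Z → undecided (widget dom Z) ≡ false × split (widget dom Z) ≡ false
  settled-if-potential-zero {dom} normal Φ≡0 Z =
    residualᵂ≡0⇒settled (normal Z) (sum≡0⇒≡0 (λ X → residualᵂ (widget dom X)) (m+n≡0⇒m≡0 _ Φ≡0) Z)

  -- With zero potential every variable is set, so Player 2 has won: some clause
  -- is unsatisfied, and its vertex c_i is still undominated.
  undominated-if-tight : ∀ dom → Tight dom → potential dom ≡ 0 → ∃ λ u → dom u ≡ false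
  undominated-if-tight dom tight Φ≡0 with Tight.phase tight | settled-if-potential-zero (Tight.normalᵂ tight) Φ≡0
  ... | two-splits (Y , _ , _ , sY , _)   | settled with () ← trans (sym (proj₂ (settled Y))) sY
  ... | player2-to-move _ _ (Y , sY , _) _ | settled with () ← trans (sym (proj₂ (settled Y))) sY
  ... | player1-to-move σ con _ (p1-move unset _) | settled
    with () ← unset (λ Z σZ → case (trans (sym (proj₁ (settled Z))) (unset⇒undecided con Z σZ)) of λ ())
  ... | player1-to-move σ con _ (finished _ unsatisfied) | _
    with any (λ i → not (dom (c i))) (allFin n) in some-undominated
  ...   | true  = let i , _ , h = any≡true⁻ _ (allFin n) some-undominated in c i , not-injective h
  ...   | false = ⊥-elim (unsatisfied λ i → clause-satisfied con i
                     (not-injective (any≡false⁻ _ some-undominated (∈-allFin i))))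

  secures-unfinished : ∀ {m dom} → Secures (suc m) dom → ∃ λ u → dom u ≡ false
  secures-unfinished {dom = dom} (inj₁ m<Φ) = undominated-if-potential dom (≤-trans (s≤s z≤n) m<Φ)
  secures-unfinished {dom = dom} (inj₂ (_ , tight)) with potential dom in Φ≡
  ... | zero  = undominated-if-tight dom tight Φ≡
  ... | suc _ = undominated-if-potential dom (subst (1 ≤_) (sym Φ≡) (s≤s z≤n))

  potential-isA : potential isA ≡ k * 3 + 2
  potential-isA = cong₂ _+_
    (trans (sum-cong-≗ (λ X → trans (cong residualᵂ (widget-isA X)) residualᵂ-fresh)) (sum-const k 3))
    (trans (cong residualᴾ pathOf-isA) residualᴾ-untouched)

  secures-initial : Even k → Player2Wins F → Secures (3 * k + 3) isA
  secures-initial (j , k≡2j) win = inj₂ (trans (shift k) (cong suc (sym potential-isA)) , record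
    { normalᵂ = λ X → subst Normalᵂ (sym (widget-isA X)) fresh
    ; normalᴾ = subst Normalᴾ (sym pathOf-isA) untouched
    ; even    = divides (j * 3 + 1) (trans potential-isA (trans (cong (λ a → a * 3 + 2) k≡2j) (halve j)))
    ; phase   = player1-to-move (λ _ → nothing) consistent
                  (λ X → trans (cong split (widget-isA X)) refl) win
    })
    where
      shift : ∀ a → 3 * a + 3 ≡ suc (a * 3 + 2)
      shift = solve-∀
      halve : ∀ a → 2 * a * 3 + 2 ≡ (a * 3 + 1) * 2
      halve = solve-∀
      consistent : Consistent (λ _ → nothing) isA
      consistent = record
        { unset⇒undecided  = λ X _ → cong undecided (widget-isA X)
        ; undecided⇒unset  = λ _ _ → refl
        ; split⇒true       = λ X spl → case trans (sym (cong split (widget-isA X))) spl of λ ()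
        ; clause-satisfied = λ _ ()
        }

module _ {k n : ℕ} where

  length-widgets : ∀ (Xs : List (Fin k)) → length (concatMap (λ X → map (w {k} {n} X) allWV) Xs) ≡ length Xs * 9
  length-widgets []       = refl
  length-widgets (X ∷ Xs) =
    trans (length-++ (map (w X) allWV) {concatMap (λ X → map (w {k} {n} X) allWV) Xs}) (cong (9 +_) (length-widgets Xs))

  3k+3≤|V| : 3 * k + 3 ≤ length (allV {k} {n})
  3k+3≤|V| rewrite length-++ (concatMap (λ X → map (w {k} {n} X) allWV) (allFin k)) {map c (allFin n) ++ map p (allFin 4)}
                 | length-++ (map (c {k} {n}) (allFin n)) {map p (allFin 4)}
                 | length-widgets (allFin k) | length-tabulate {n = k} (λ X → X) =
    +-mono-≤ 3k≤9k (≤-trans (n≤1+n 3) (m≤n+m 4 (length (map (c {k} {n}) (allFin n)))))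
    where
      3k≤9k : 3 * k ≤ k * 9
      3k≤9k = ≤-trans (*-monoˡ-≤ k {3} {9} (s≤s (s≤s (s≤s z≤n)))) (≤-reflexive (*-comm 9 k))

lemma2 : (k n : ℕ) → Even k → (F : PosCNF k n) → Player2Wins F →
         3 * k + 3 ≤ γg (GF F) isA
lemma2 k n k-even F win =
  value-≥ staller (length (allV {k} {n})) (3 * k + 3) isA (3k+3≤|V| {k} {n}) (secures-initial k-even win)
  where
    open OnGF F
    open Tightness F
    open StallerLowerBound (GF F) eqVk-refl allV-complete
    staller : StallerInvariant
    staller = record { Secures = Secures ; unfinished = secures-unfinished ; reply = staller-reply }
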